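{- For every $n$ there is a bijection $f_{5,1}$ from $\mathcal{T}_{5,1}\cap\mathcal{A}_n$ onto the set of ascent sequences $s\in\mathcal{A}_n$ with $\mathrm{rpos}(s)\ne0$ such that (a) the rightmost occurrence of $\mathrm{Rmin}(s)_{\mathrm{rpos}(s)-1}$ is immediately followed by the second rightmost occurrence of $\mathrm{Rmin}(s)_{\mathrm{rpos}(s)}$, and (b) the two rightmost occurrences of $\mathrm{Rmin}(s)_{\mathrm{rpos}(s)}$ are not adjacent and no $\mathcal{M}$asc lies strictly between them. Moreover, for all $s\in\mathcal{T}_{5,1}\cap\mathcal{A}_n$: $\mathrm{asc},\mathrm{rep},\max,\mathrm{ealm},\mathrm{rmin}$ take the same values on $s$ and $f_{5,1}(s)$, $\mathrm{rpos}(s)=\mathrm{rpos}(f_{5,1}(s))-1$, and $\mathrm{zero}(s)=\mathrm{zero}(f_{5,1}(s))+\chi(\mathrm{rpos}(s)=0)$.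
   Context: Inversion sequence: $s=(s_1,\dots,s_n)$, $0\le s_i<i$, $|s|=n$. $\mathrm{asc}(s)=|\{i:s_i<s_{i+1}\}|$. Ascent sequence: $s_i\le\mathrm{asc}(s_1,\dots,s_{i-1})+1$ for $i\ge2$; $\mathcal{A}_n$ = ascent sequences of length $n$; $\mathcal{A}^*$ = all ascent sequences except $(0,1,\dots,|s|-1)$. $\mathrm{rep}(s)=n-|\{s_i\}|$, $\mathrm{zero}(s)=|\{i:s_i=0\}|$, $\max(s)=|\{i:s_i=i-1\}|$, $\mathrm{ealm}(s)=s_{\max(s)+1}$ if $\max(s)\ne|s|$ and $0$ otherwise. An entry $s_i$ is an $\mathcal{M}$asc if $s_i=\mathrm{asc}(s_1,\dots,s_{i-1})+1$. $\mathrm{Rmin}(s)=\{s_i:s_i<s_j\ \forall j>i\}$, $\mathrm{rmin}(s)=|\mathrm{Rmin}(s)|$, $\mathrm{Rmin}(s)_j$ its $j$-th smallest element ($j\ge0$); $\mathrm{Prm}(s)$ = set of positions of right-to-left minima, $\mathrm{Prm}(s)_j$ its $j$-th smallest element ($j\ge0$). $\mathrm{rpos}(s)$ is the maximal $m$ such that $\mathrm{Rmin}(s)_m$ occurs at least twice after position $\mathrm{Prm}(s)_{m-1}$ (for $m=0$: at least twice in $s$); $0$ if none exists or $\mathrm{rmin}(s)=|s|$. $\mathrm{sebr}(s)$ = smallest entry strictly between the two rightmost occurrences of $\mathrm{Rmin}(s)_{\mathrm{rpos}(s)}$ ($0$ if adjacent). $\mathcal{A}^1=\{s\in\mathcal{A}^*:\mathrm{rpos}(s)<\mathrm{rmin}(s)-1,\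 \mathrm{sebr}(s)\ge\mathrm{Rmin}(s)_{\mathrm{rpos}(s)+1}\}$ and $\mathcal{T}_{5,1}=\{s\in\mathcal{A}^1:\mathrm{sebr}(s)>\mathrm{Rmin}(s)_{\mathrm{rpos}(s)+1},\ \mathrm{Prm}(s)_{\mathrm{rpos}(s)+1}=\mathrm{Prm}(s)_{\mathrm{rpos}(s)}+1\}$. $\chi(P)$ is $1$ if $P$ holds and $0$ otherwise. -}

module Defs where

open import Data.Bool using (Bool; true; false; _∧_; _∨_; not; if_then_else_; T)
open import Data.Nat using (ℕ; zero; suc; _+_; _∸_; _⊓_; _≡ᵇ_; _<ᵇ_; _≤ᵇ_)
open import Data.List using (List; []; _∷_; length; map; filterᵇ; deduplicateᵇ;  upTo; drop; take; reverse; foldr; foldl)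
open import Data.Maybe using (Maybe; just; nothing)
open import Data.Product using (_×_; _,_)
open import Relation.Binary.PropositionalEquality using (_≡_)

-- Sequences are lists of naturals; positions are 1-based: s = (s_1,...,s_n).

-- s_i (1-based), default 0 outside the range
at : List ℕ → ℕ → ℕ
at []       _             = 0
at (x ∷ xs) zero          = 0
at (x ∷ xs) (suc zero)    = x
at (x ∷ xs) (suc (suc k)) = at xs (suc k)

-- j-th element (0-based), default 0
at0 : List ℕ → ℕ → ℕ
at0 []       _       = 0
at0 (x ∷ xs) zero    = x
at0 (x ∷ xs) (suc j) = at0 xs j

pos : List ℕ → List ℕ
pos s = map suc (upTo (length s))

all : (ℕ → Bool) → List ℕ → Bool
all p []       = true
all p (x ∷ xs) = p x ∧ all p xs

count : (ℕ → Bool) → List ℕ → ℕ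
count p l = length (filterᵇ p l)

asc : List ℕ → ℕ
asc []           = 0
asc (x ∷ [])     = 0
asc (x ∷ y ∷ ys) = (if x <ᵇ y then 1 else 0) + asc (y ∷ ys)

isInversion : List ℕ → Bool
isInversion s = all (λ i → at s i <ᵇ i) (pos s)

isAscent : List ℕ → Bool
isAscent s = isInversion s ∧ all (λ i → (i ≤ᵇ 1) ∨ (at s i ≤ᵇ asc (take (i ∸ 1) s) + 1)) (pos s)

isIdentity : List ℕ → Bool
isIdentity s = all (λ i → at s i ≡ᵇ i ∸ 1) (pos s)

inAstar : List ℕ → Bool
inAstar s = isAscent s ∧ not (isIdentity s)

rep : List ℕ → ℕ
rep s = length s ∸ length (deduplicateᵇ _≡ᵇ_ s)

zeros : List ℕ → ℕ
zeros s = count (λ x → x ≡ᵇ 0) s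

maxs : List ℕ → ℕ
maxs s = count (λ i → at s i ≡ᵇ i ∸ 1) (pos s)

ealm : List ℕ → ℕ
ealm s = if maxs s ≡ᵇ length s then 0 else at s (maxs s + 1)

isMasc : List ℕ → ℕ → Bool
isMasc s i = at s i ≡ᵇ asc (take (i ∸ 1) s) + 1

isRminPos : List ℕ → ℕ → Bool
isRminPos s i = all (λ y → at s i <ᵇ y) (drop i s)

Prm : List ℕ → List ℕ
Prm s = filterᵇ (isRminPos s) (pos s)

-- Rmin(s), listed in increasing order (right-to-left minima values increase
-- from left to right, so listing by position lists them in increasing order)
Rmin : List ℕ → List ℕ
Rmin s = map (at s) (Prm s)

rmin : List ℕ → ℕ
rmin s = length (Prm s)

RminAt : List ℕ → ℕ → ℕ
RminAt s j = at0 (Rmin s) j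

PrmAt : List ℕ → ℕ → ℕ
PrmAt s j = at0 (Prm s) j

occAfter : List ℕ → ℕ → ℕ → ℕ
occAfter s v p = count (λ i → (p <ᵇ i) ∧ (at s i ≡ᵇ v)) (pos s)

qualifies : List ℕ → ℕ → Bool
qualifies s zero    = 2 ≤ᵇ occAfter s (RminAt s 0) 0
qualifies s (suc m) = 2 ≤ᵇ occAfter s (RminAt s (suc m)) (PrmAt s m)

-- rpos(s): maximal qualifying m in {0,...,rmin(s)-1}; 0 if none or rmin(s) = |s|
rpos : List ℕ → ℕ
rpos s = if rmin s ≡ᵇ length s then 0
         else foldl (λ acc m → if qualifies s m then m else acc) 0 (upTo (rmin s))

occPositions : List ℕ → ℕ → List ℕ
occPositions s v = filterᵇ (λ i → at s i ≡ᵇ v) (pos s)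

lastTwo : List ℕ → Maybe (ℕ × ℕ)
lastTwo l with reverse l
... | q ∷ p ∷ _ = just (p , q)
... | _         = nothing

lastOf : List ℕ → ℕ
lastOf l with reverse l
... | q ∷ _ = q
... | []    = 0

minList : List ℕ → ℕ
minList []       = 0
minList (x ∷ xs) = foldr _⊓_ x xs

between : List ℕ → ℕ → ℕ → List ℕ
between s p q = filterᵇ (λ i → (p <ᵇ i) ∧ (i <ᵇ q)) (pos s)

-- sebr(s): smallest entry strictly between the two rightmost occurrences of
-- Rmin(s)_{rpos(s)}; 0 if they are adjacent (or, by convention, if there are
-- fewer than two occurrences)
sebr : List ℕ → ℕ
sebr s with lastTwo (occPositions s (RminAt s (rpos s)))
... | just (p , q) = minList (map (at s) (between s p q))
... | nothing      = 0

inA1 : List ℕ → Bool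
inA1 s = inAstar s ∧ (rpos s + 1 <ᵇ rmin s) ∧ (RminAt s (rpos s + 1) ≤ᵇ sebr s)

inT51 : List ℕ → Bool
inT51 s = inA1 s ∧ (RminAt s (rpos s + 1) <ᵇ sebr s)
                 ∧ (PrmAt s (rpos s + 1) ≡ᵇ PrmAt s (rpos s) + 1)

condA : List ℕ → Bool
condA s with lastTwo (occPositions s (RminAt s (rpos s)))
... | just (p , q) = lastOf (occPositions s (RminAt s (rpos s ∸ 1))) + 1 ≡ᵇ p
... | nothing      = false

condB : List ℕ → Bool
condB s with lastTwo (occPositions s (RminAt s (rpos s)))
... | just (p , q) = (p + 1 <ᵇ q) ∧ all (λ i → not (isMasc s i)) (between s p q)
... | nothing      = false

-- the codomain of f_{5,1} (length condition stated separately)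
inTarget : List ℕ → Bool
inTarget s = isAscent s ∧ not (rpos s ≡ᵇ 0) ∧ condA s ∧ condB s

χ : Bool → ℕ
χ true  = 1
χ false = 0

InDom : ℕ → List ℕ → Set
InDom n s = (length s ≡ n) × T (inT51 s)

InCod : ℕ → List ℕ → Set
InCod n s = (length s ≡ n) × T (inTarget s)

-- Write k = rpos(s), r = Rmin(s)_k and r′ = Rmin(s)_(k+1). For s ∈ 𝒯_{5,1} the conditions on sebr and Prm force
-- s = A r X r r′ B with X nonempty, every entry of X and B above r′, and no index of B qualifying for rpos.
-- The bijection is f(s) = A r r′ X r′ B, inverted by cutting at the last two occurrences of r′. In f(s), r and r′
-- are still the k-th and (k+1)-st right-to-left minima but now r′ occurs twice after r, so rpos grows by one and (a)
-- holds. Moving r′ in front of X adds exactly one ascent before X, so X keeps satisfying the ascent bound precisely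
-- when it contains no 𝓜asc of f(s), which is (b). The set of values, the length and the ascents are unchanged,
-- giving rep, asc and rmin. At r the ascent bound already lags behind the positions, so all fixed points lie in A,
-- which gives max and ealm; finally s has one more 0 than f(s) exactly when r = 0, that is when k = 0.

module Submission where

open import Defs
open import Data.Bool using (Bool; true; false; _∧_; _∨_; not; if_then_else_; T)
open import Data.Bool.Properties using (∧-zeroʳ; ∨-zeroʳ)
open import Data.Nat using (ℕ; zero; suc; z<s; _+_; _∸_; _⊓_; _≡ᵇ_; _<ᵇ_; _≤ᵇ_; _≤_; _<_; z≤n; s≤s)
open import Data.Nat.Properties
open import Data.List using (List; []; _∷_; length; map; filterᵇ; filter; deduplicateᵇ; upTo; applyUpTo; drop; take; foldr; foldl; _++_)
open import Data.List.Properties using (++-assoc; ++-identityʳ; length-++; map-++; map-upTo; reverse-++; length-map; map-∘; map-cong; upTo-∷ʳ; foldl-∷ʳ; map-id; ∷-injective)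
open import Data.Maybe using (Maybe; just; nothing)
open import Data.Product using (Σ; ∃; _×_; _,_; proj₁; proj₂)
open import Data.Sum using (inj₁; inj₂)
open import Data.Unit using (tt)
open import Data.Empty using (⊥; ⊥-elim)
open import Function using (_∘_)
open import Relation.Nullary using (yes; no; does)
open import Relation.Unary using (Decidable)
open import Relation.Binary.PropositionalEquality

split-∧ : ∀ {a b} → T (a ∧ b) → T a × T b
split-∧ {true} {true} _ = tt , tt

pair-∧ : ∀ {a b} → T a → T b → T (a ∧ b)
pair-∧ {true} {true} _ _ = tt

split-∧₆ : ∀ {a b c d e f} → T (a ∧ (b ∧ (c ∧ (d ∧ (e ∧ f))))) → T a × T b × T c × T d × T e × T f
split-∧₆ {true} {true} {true} {true} {true} {true} _ = tt , tt , tt , tt , tt , tt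

pair-∧₆ : ∀ {a b c d e f} → T a → T b → T c → T d → T e → T f → T (a ∧ (b ∧ (c ∧ (d ∧ (e ∧ f)))))
pair-∧₆ {true} {true} {true} {true} {true} {true} _ _ _ _ _ _ = tt

resolve-∨ : ∀ {a b} → T (a ∨ b) → (T a → ⊥) → T b
resolve-∨ {true} _ ¬a = ⊥-elim (¬a tt)
resolve-∨ {false} {true} _ _ = tt

inj-∨ʳ : ∀ {a b} → T b → T (a ∨ b)
inj-∨ʳ {true} _ = tt
inj-∨ʳ {false} t = t

T-not⇒¬T : ∀ {a} → T (not a) → T a → ⊥
T-not⇒¬T {false} _ ()

¬T⇒T-not : ∀ {a} → (T a → ⊥) → T (not a)
¬T⇒T-not {true} ¬a = ¬a tt
¬T⇒T-not {false} _ = tt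

T⇒≡true : ∀ {a} → T a → a ≡ true
T⇒≡true {true} _ = refl

≡true⇒T : ∀ {a} → a ≡ true → T a
≡true⇒T refl = tt

¬T⇒≡false : ∀ {a} → (T a → ⊥) → a ≡ false
¬T⇒≡false {true} ¬a = ⊥-elim (¬a tt)
¬T⇒≡false {false} _ = refl

T-extensional : ∀ {a b} → (T a → T b) → (T b → T a) → a ≡ b
T-extensional {true} {true} _ _ = refl
T-extensional {true} {false} f _ = ⊥-elim (f tt)
T-extensional {false} {true} _ g = ⊥-elim (g tt)
T-extensional {false} {false} _ _ = refl

b2n : Bool → ℕ
b2n true = 1
b2n false = 0

b2n-if : ∀ b → (if b then 1 else 0) ≡ b2n b
b2n-if true = refl
b2n-if false = refl

≡ᵇ-refl : ∀ v → (v ≡ᵇ v) ≡ true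
≡ᵇ-refl v = T⇒≡true (≡⇒≡ᵇ v v refl)

≡ᵇ-sym : ∀ x y → (x ≡ᵇ y) ≡ (y ≡ᵇ x)
≡ᵇ-sym zero zero = refl
≡ᵇ-sym zero (suc y) = refl
≡ᵇ-sym (suc x) zero = refl
≡ᵇ-sym (suc x) (suc y) = ≡ᵇ-sym x y

≥⇒<ᵇ-false : ∀ {a b} → b ≤ a → (a <ᵇ b) ≡ false
≥⇒<ᵇ-false b≤a = ¬T⇒≡false (λ t → <⇒≱ (<ᵇ⇒< _ _ t) b≤a)

all-++ : ∀ p (l m : List ℕ) → all p (l ++ m) ≡ all p l ∧ all p m
all-++ p [] m = refl
all-++ p (x ∷ l) m rewrite all-++ p l m with p x
... | true = refl
... | false = refl

all-map : ∀ p (f : ℕ → ℕ) l → all p (map f l) ≡ all (p ∘ f) l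
all-map p f [] = refl
all-map p f (x ∷ l) = cong (p (f x) ∧_) (all-map p f l)

all-cong : ∀ {p q} → (∀ x → p x ≡ q x) → ∀ l → all p l ≡ all q l
all-cong p≗q [] = refl
all-cong p≗q (x ∷ l) = cong₂ _∧_ (p≗q x) (all-cong p≗q l)

all-mono : ∀ {p q} → (∀ x → T (p x) → T (q x)) → ∀ l → T (all p l) → T (all q l)
all-mono p⇒q [] _ = tt
all-mono p⇒q (x ∷ l) h = let (px , pl) = split-∧ h in pair-∧ (p⇒q x px) (all-mono p⇒q l pl)

filterᵇ-∷ : ∀ (p : ℕ → Bool) x l → filterᵇ p (x ∷ l) ≡ (if p x then x ∷ filterᵇ p l else filterᵇ p l)
filterᵇ-∷ p x l with p x
... | true = refl
... | false = refl

filterᵇ-map : ∀ p (f : ℕ → ℕ) l → filterᵇ p (map f l) ≡ map f (filterᵇ (p ∘ f) l)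
filterᵇ-map p f [] = refl
filterᵇ-map p f (x ∷ l) rewrite filterᵇ-∷ p (f x) (map f l) | filterᵇ-∷ (p ∘ f) x l | filterᵇ-map p f l with p (f x)
... | true = refl
... | false = refl

filterᵇ-cong : ∀ {p q} → (∀ x → p x ≡ q x) → ∀ l → filterᵇ p l ≡ filterᵇ q l
filterᵇ-cong {p} {q} p≗q [] = refl
filterᵇ-cong {p} {q} p≗q (x ∷ l) rewrite filterᵇ-∷ p x l | filterᵇ-∷ q x l | p≗q x | filterᵇ-cong p≗q l = refl

all-filterᵇ : ∀ p q l → all p (filterᵇ q l) ≡ all (λ i → not (q i) ∨ p i) l
all-filterᵇ p q [] = refl
all-filterᵇ p q (x ∷ l) rewrite filterᵇ-∷ q x l with q x
... | true = cong (p x ∧_) (all-filterᵇ p q l)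
... | false = all-filterᵇ p q l

allGt : ℕ → List ℕ → Bool
allGt x l = all (λ y → x <ᵇ y) l

allGe : ℕ → List ℕ → Bool
allGe x l = all (λ y → x ≤ᵇ y) l

allGt⇒allGe : ∀ m l → T (allGt m l) → T (allGe m l)
allGt⇒allGe m = all-mono (λ y t → ≤⇒≤ᵇ (<⇒≤ (<ᵇ⇒< m y t)))

allGt-≤ : ∀ {a b} l → a < b → T (allGt b l) → T (allGt a l)
allGt-≤ {a} {b} l a<b = all-mono (λ y t → <⇒<ᵇ (<-trans a<b (<ᵇ⇒< b y t))) l

_∉_ : ℕ → List ℕ → Set
v ∉ l = T (all (λ y → not (y ≡ᵇ v)) l)

∉-++⁻ : ∀ v l m → v ∉ (l ++ m) → v ∉ l × v ∉ m
∉-++⁻ v l m h rewrite all-++ (λ y → not (y ≡ᵇ v)) l m = split-∧ h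

∉-∷ʳ-absurd : ∀ v L R → v ∉ (L ++ v ∷ R) → ⊥
∉-∷ʳ-absurd v L R h = T-not⇒¬T (proj₁ (split-∧ (proj₂ (∉-++⁻ v L (v ∷ R) h)))) (≡⇒≡ᵇ v v refl)

allGt⇒∉ : ∀ v l → T (allGt v l) → v ∉ l
allGt⇒∉ v = all-mono (λ y v<y → ¬T⇒T-not (λ y≡v → <-irrefl (sym (≡ᵇ⇒≡ y v y≡v)) (<ᵇ⇒< v y v<y)))

allGe∧∉⇒allGt : ∀ m l → T (allGe m l) → m ∉ l → T (allGt m l)
allGe∧∉⇒allGt m [] _ _ = tt
allGe∧∉⇒allGt m (y ∷ l) ge ∉ with y ≡ᵇ m in y≡ᵇm
... | false = pair-∧ {m <ᵇ y} (<⇒<ᵇ (≤∧≢⇒< (≤ᵇ⇒≤ m y (proj₁ (split-∧ {m ≤ᵇ y} ge))) m≢y))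
                     (allGe∧∉⇒allGt m l (proj₂ (split-∧ {m ≤ᵇ y} ge)) ∉)
  where
  m≢y : m ≢ y
  m≢y m≡y = subst T y≡ᵇm (≡⇒≡ᵇ y m (sym m≡y))

occ : ℕ → List ℕ → ℕ
occ v l = count (λ x → x ≡ᵇ v) l

occ-∷ : ∀ v x l → occ v (x ∷ l) ≡ (if x ≡ᵇ v then suc (occ v l) else occ v l)
occ-∷ v x l with x ≡ᵇ v
... | true = refl
... | false = refl

occ-self : ∀ v l → occ v (v ∷ l) ≡ suc (occ v l)
occ-self v l rewrite occ-∷ v v l | ≡ᵇ-refl v = refl

occ-++ : ∀ v l m → occ v (l ++ m) ≡ occ v l + occ v m
occ-++ v [] m = refl
occ-++ v (x ∷ l) m rewrite occ-∷ v x (l ++ m) | occ-∷ v x l | occ-++ v l m with x ≡ᵇ v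
... | true = refl
... | false = refl

∉⇒occ≡0 : ∀ v l → v ∉ l → occ v l ≡ 0
∉⇒occ≡0 v [] _ = refl
∉⇒occ≡0 v (x ∷ l) h rewrite occ-∷ v x l with x ≡ᵇ v
... | false = ∉⇒occ≡0 v l h

occ-drop-antimono : ∀ v {a b} (l : List ℕ) → a ≤ b → occ v (drop b l) ≤ occ v (drop a l)
occ-drop-antimono v {zero} {zero} l _ = ≤-refl
occ-drop-antimono v {zero} {suc b} [] _ = ≤-refl
occ-drop-antimono v {zero} {suc b} (x ∷ l) _ rewrite occ-∷ v x l with x ≡ᵇ v
... | true = ≤-trans (occ-drop-antimono v {0} {b} l z≤n) (n≤1+n _)
... | false = occ-drop-antimono v {0} {b} l z≤n
occ-drop-antimono v {suc a} {suc b} [] _ = ≤-refl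
occ-drop-antimono v {suc a} {suc b} (x ∷ l) (s≤s a≤b) = occ-drop-antimono v l a≤b

drop-length-++ : ∀ (A : List ℕ) M → drop (length A) (A ++ M) ≡ M
drop-length-++ [] M = refl
drop-length-++ (x ∷ A) M = drop-length-++ A M

length-∷ʳ : ∀ (P : List ℕ) y → length (P ++ y ∷ []) ≡ suc (length P)
length-∷ʳ P y = trans (length-++ P) (+-comm (length P) 1)

at-++-∷ : ∀ (A : List ℕ) r R R′ i → i ≤ suc (length A) → at (A ++ r ∷ R) i ≡ at (A ++ r ∷ R′) i
at-++-∷ [] r R R′ zero _ = refl
at-++-∷ [] r R R′ (suc zero) _ = refl
at-++-∷ [] r R R′ (suc (suc i)) (s≤s ())
at-++-∷ (a ∷ A) r R R′ zero _ = refl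
at-++-∷ (a ∷ A) r R R′ (suc zero) _ = refl
at-++-∷ (a ∷ A) r R R′ (suc (suc i)) (s≤s i≤) = at-++-∷ A r R R′ (suc i) i≤

last-occurrence-unique : ∀ v L R L′ R′ → L ++ v ∷ R ≡ L′ ++ v ∷ R′ → v ∉ R → v ∉ R′ → (L ≡ L′) × (R ≡ R′)
last-occurrence-unique v [] R [] R′ e _ _ = refl , proj₂ (∷-injective e)
last-occurrence-unique v [] R (x ∷ L′) R′ e ∉R _ = ⊥-elim (∉-∷ʳ-absurd v L′ R′ (subst (v ∉_) (proj₂ (∷-injective e)) ∉R))
last-occurrence-unique v (x ∷ L) R [] R′ e _ ∉R′ = ⊥-elim (∉-∷ʳ-absurd v L R (subst (v ∉_) (sym (proj₂ (∷-injective e))) ∉R′))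
last-occurrence-unique v (x ∷ L) R (x′ ∷ L′) R′ e ∉R ∉R′ with ∷-injective e
... | x≡x′ , e′ = let (L≡L′ , R≡R′) = last-occurrence-unique v L R L′ R′ e′ ∉R ∉R′ in cong₂ _∷_ x≡x′ L≡L′ , R≡R′

split-at-next : ∀ (L : List ℕ) x R L′ y R′ → L ++ x ∷ R ≡ L′ ++ y ∷ R′ → length L′ ≡ suc (length L) → (L′ ≡ L ++ x ∷ []) × (R ≡ y ∷ R′)
split-at-next [] x R (x′ ∷ []) y R′ e _ = let (x≡x′ , R≡) = ∷-injective e in cong (_∷ []) (sym x≡x′) , R≡
split-at-next (z ∷ L) x R (z′ ∷ L′) y R′ e l with ∷-injective e
... | z≡z′ , e′ = let (L′≡ , R≡) = split-at-next L x R L′ y R′ e′ (suc-injective l) in cong₂ _∷_ (sym z≡z′) L′≡ , R≡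

splitLast : ℕ → List ℕ → Maybe (List ℕ × List ℕ)
splitLast v [] = nothing
splitLast v (x ∷ xs) with splitLast v xs
... | just (L , R) = just (x ∷ L , R)
... | nothing = if x ≡ᵇ v then just ([] , xs) else nothing

splitLast-∉ : ∀ v s → v ∉ s → splitLast v s ≡ nothing
splitLast-∉ v [] _ = refl
splitLast-∉ v (x ∷ s) h rewrite splitLast-∉ v s (proj₂ (split-∧ {not (x ≡ᵇ v)} h)) with x ≡ᵇ v
... | false = refl

splitLast-last : ∀ v L R → v ∉ R → splitLast v (L ++ v ∷ R) ≡ just (L , R)
splitLast-last v [] R h rewrite splitLast-∉ v R h | ≡ᵇ-refl v = refl
splitLast-last v (x ∷ L) R h rewrite splitLast-last v L R h = refl

data LastOccurrence (v : ℕ) (s : List ℕ) : Set where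
  absent : v ∉ s → LastOccurrence v s
  last-at : ∀ L R → s ≡ L ++ v ∷ R → v ∉ R → LastOccurrence v s

lastOccurrence : ∀ v s → LastOccurrence v s
lastOccurrence v [] = absent tt
lastOccurrence v (x ∷ s) with lastOccurrence v s
... | last-at L R e ∉R = last-at (x ∷ L) R (cong (x ∷_) e) ∉R
... | absent ∉s with x ≡ᵇ v in x≡ᵇv
... | true = last-at [] s (cong (_∷ s) (≡ᵇ⇒≡ x v (≡true⇒T x≡ᵇv))) ∉s
... | false = absent (pair-∧ (subst (λ b → T (not b)) (sym x≡ᵇv) tt) ∉s)

lastBelow : (ℕ → Bool) → ℕ → ℕ
lastBelow Q N = foldl (λ acc m → if Q m then m else acc) 0 (upTo N)

lastBelow-suc : ∀ Q N → lastBelow Q (suc N) ≡ (if Q N then N else lastBelow Q N)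
lastBelow-suc Q N = trans (cong (foldl (λ acc m → if Q m then m else acc) 0) (sym (upTo-∷ʳ N))) (foldl-∷ʳ _ 0 N (upTo N))

lastBelow-≡ : ∀ Q N K → Q K ≡ true → K < N → (∀ m → K < m → m < N → Q m ≡ false) → lastBelow Q N ≡ K
lastBelow-≡ Q (suc N) K QK (s≤s K≤N) none with m≤n⇒m<n∨m≡n K≤N
... | inj₂ refl rewrite lastBelow-suc Q N | QK = refl
... | inj₁ K<N rewrite lastBelow-suc Q N | none N K<N ≤-refl = lastBelow-≡ Q N K QK K<N (λ m a b → none m a (≤-trans b (n≤1+n _)))

lastBelow-maximal : ∀ Q N K → lastBelow Q N ≡ K → ∀ m → K < m → m < N → Q m ≡ false
lastBelow-maximal Q (suc N) K e m K<m (s≤s m≤N) with Q N in QN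
... | true rewrite lastBelow-suc Q N | QN = ⊥-elim (<-irrefl refl (≤-trans K<m (subst (m ≤_) e m≤N)))
... | false rewrite lastBelow-suc Q N | QN with m ≟ N
... | yes refl = QN
... | no m≢N = lastBelow-maximal Q N K e m K<m (≤∧≢⇒< m≤N m≢N)

lastBelow-suc-holds : ∀ Q N K → lastBelow Q N ≡ suc K → (Q (suc K) ≡ true) × (suc K < N)
lastBelow-suc-holds Q (suc N) K e with Q N in QN
... | true rewrite lastBelow-suc Q N | QN | sym e = QN , ≤-refl
... | false rewrite lastBelow-suc Q N | QN = let (h , lt) = lastBelow-suc-holds Q N K e in h , ≤-trans lt (n≤1+n _)

-- A test sees a position i (1-based), the entries before it, the entry s_i and the entries after it.
-- allScan Φ P Y S and selectScan h Φ P Y S run Φ over the entries of Y read inside P ++ Y ++ S.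

Test : Set
Test = ℕ → List ℕ → ℕ → List ℕ → Bool

allScan : Test → List ℕ → List ℕ → List ℕ → Bool
allScan Φ P [] S = true
allScan Φ P (y ∷ Y) S = Φ (suc (length P)) P y (Y ++ S) ∧ allScan Φ (P ++ y ∷ []) Y S

selectScan : (ℕ → ℕ → ℕ) → Test → List ℕ → List ℕ → List ℕ → List ℕ
selectScan h Φ P [] S = []
selectScan h Φ P (y ∷ Y) S = if Φ (suc (length P)) P y (Y ++ S)
  then h (suc (length P)) y ∷ selectScan h Φ (P ++ y ∷ []) Y S
  else selectScan h Φ (P ++ y ∷ []) Y S

length-∷ʳ-+ : ∀ (P : List ℕ) y k → length (P ++ y ∷ []) + suc k ≡ length P + suc (suc k)
length-∷ʳ-+ P y k rewrite length-∷ʳ P y = sym (+-suc (length P) (suc k))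

posTest : Test → List ℕ → ℕ → Bool
posTest Φ s i = Φ i (take (i ∸ 1) s) (at s i) (drop i s)

shiftedTest : Test → List ℕ → List ℕ → ℕ → Bool
shiftedTest Φ P s k = Φ (length P + suc k) (P ++ take k s) (at s (suc k)) (drop (suc k) s)

shiftedTest-∷ : ∀ Φ P y Y k → shiftedTest Φ P (y ∷ Y) (suc k) ≡ shiftedTest Φ (P ++ y ∷ []) Y k
shiftedTest-∷ Φ P y Y k = cong₂ (λ a b → Φ a b (at Y (suc k)) (drop (suc k) Y)) (sym (length-∷ʳ-+ P y k)) (sym (++-assoc P (y ∷ []) (take k Y)))

shiftedTest-head : ∀ Φ P y Y → shiftedTest Φ P (y ∷ Y) 0 ≡ Φ (suc (length P)) P y (Y ++ [])
shiftedTest-head Φ P y Y rewrite +-comm (length P) 1 | ++-identityʳ P | ++-identityʳ Y = refl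

allScan-shifted : ∀ Φ P s → all (shiftedTest Φ P s) (upTo (length s)) ≡ allScan Φ P s []
allScan-shifted Φ P [] = refl
allScan-shifted Φ P (y ∷ Y) = cong₂ _∧_ (shiftedTest-head Φ P y Y) (begin
    all (shiftedTest Φ P (y ∷ Y)) (applyUpTo suc (length Y))       ≡⟨ cong (all _) (sym (map-upTo suc (length Y))) ⟩
    all (shiftedTest Φ P (y ∷ Y)) (map suc (upTo (length Y)))      ≡⟨ all-map _ suc (upTo (length Y)) ⟩
    all (shiftedTest Φ P (y ∷ Y) ∘ suc) (upTo (length Y))          ≡⟨ all-cong (shiftedTest-∷ Φ P y Y) (upTo (length Y)) ⟩
    all (shiftedTest Φ (P ++ y ∷ []) Y) (upTo (length Y))          ≡⟨ allScan-shifted Φ (P ++ y ∷ []) Y ⟩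
    allScan Φ (P ++ y ∷ []) Y [] ∎)
  where open ≡-Reasoning

all-pos≡allScan : ∀ Φ s → all (posTest Φ s) (pos s) ≡ allScan Φ [] s []
all-pos≡allScan Φ s = trans (all-map _ suc (upTo (length s))) (allScan-shifted Φ [] s)

selectScan-shifted : ∀ h Φ P s → map (λ k → h (length P + suc k) (at s (suc k))) (filterᵇ (shiftedTest Φ P s) (upTo (length s))) ≡ selectScan h Φ P s []
selectScan-shifted h Φ P [] = refl
selectScan-shifted h Φ P (y ∷ Y) = unfold-head
  where
  H : ℕ → ℕ
  H k = h (length P + suc k) (at (y ∷ Y) (suc k))
  tail : map H (filterᵇ (shiftedTest Φ P (y ∷ Y)) (applyUpTo suc (length Y))) ≡ selectScan h Φ (P ++ y ∷ []) Y []
  tail rewrite sym (map-upTo suc (length Y)) | filterᵇ-map (shiftedTest Φ P (y ∷ Y)) suc (upTo (length Y))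
     | sym (map-∘ {g = H} {f = suc} (filterᵇ (shiftedTest Φ P (y ∷ Y) ∘ suc) (upTo (length Y))))
     | filterᵇ-cong (shiftedTest-∷ Φ P y Y) (upTo (length Y))
     = trans (map-cong (λ k → cong (λ a → h a (at Y (suc k))) (sym (length-∷ʳ-+ P y k))) _) (selectScan-shifted h Φ (P ++ y ∷ []) Y)
  unfold-head : map H (filterᵇ (shiftedTest Φ P (y ∷ Y)) (0 ∷ applyUpTo suc (length Y))) ≡ selectScan h Φ P (y ∷ Y) []
  unfold-head rewrite filterᵇ-∷ (shiftedTest Φ P (y ∷ Y)) 0 (applyUpTo suc (length Y)) | shiftedTest-head Φ P y Y
    with Φ (suc (length P)) P y (Y ++ [])
  ... | true = cong₂ _∷_ (cong (λ a → h a y) (+-comm (length P) 1)) tail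
  ... | false = tail

map-filter-pos≡selectScan : ∀ h Φ s → map (λ i → h i (at s i)) (filterᵇ (posTest Φ s) (pos s)) ≡ selectScan h Φ [] s []
map-filter-pos≡selectScan h Φ s
  rewrite filterᵇ-map (posTest Φ s) suc (upTo (length s))
        | sym (map-∘ {g = λ i → h i (at s i)} {f = suc} (filterᵇ (posTest Φ s ∘ suc) (upTo (length s))))
  = selectScan-shifted h Φ [] s
allScan-++ : ∀ Φ P Y Z S → allScan Φ P (Y ++ Z) S ≡ allScan Φ P Y (Z ++ S) ∧ allScan Φ (P ++ Y) Z S
allScan-++ Φ P [] Z S rewrite ++-identityʳ P = refl
allScan-++ Φ P (y ∷ Y) Z S rewrite allScan-++ Φ (P ++ y ∷ []) Y Z S | ++-assoc P (y ∷ []) Y | ++-assoc Y Z S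
  with Φ (suc (length P)) P y (Y ++ Z ++ S)
... | true = refl
... | false = refl

selectScan-++ : ∀ h Φ P Y Z S → selectScan h Φ P (Y ++ Z) S ≡ selectScan h Φ P Y (Z ++ S) ++ selectScan h Φ (P ++ Y) Z S
selectScan-++ h Φ P [] Z S rewrite ++-identityʳ P = refl
selectScan-++ h Φ P (y ∷ Y) Z S rewrite selectScan-++ h Φ (P ++ y ∷ []) Y Z S | ++-assoc P (y ∷ []) Y | ++-assoc Y Z S
  with Φ (suc (length P)) P y (Y ++ Z ++ S)
... | true = refl
... | false = refl

AgreeOn : List ℕ → List ℕ → Test → Test → Set
AgreeOn P Y Φ Ψ = ∀ i Q w U → suc (length P) ≤ i → i ≤ length P + length Y → Φ i Q w U ≡ Ψ i Q w U

AgreeOn-head : ∀ {Φ Ψ} P y Y S → AgreeOn P (y ∷ Y) Φ Ψ → Φ (suc (length P)) P y (Y ++ S) ≡ Ψ (suc (length P)) P y (Y ++ S)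
AgreeOn-head P y Y S agree = agree _ _ _ _ ≤-refl (subst (suc (length P) ≤_) (sym (+-suc (length P) (length Y))) (s≤s (m≤m+n (length P) (length Y))))

AgreeOn-tail : ∀ {Φ Ψ} P y Y → AgreeOn P (y ∷ Y) Φ Ψ → AgreeOn (P ++ y ∷ []) Y Φ Ψ
AgreeOn-tail P y Y agree i Q w U lo hi rewrite length-∷ʳ P y =
  agree i Q w U (≤-trans (n≤1+n _) lo) (≤-trans hi (≤-reflexive (sym (+-suc (length P) (length Y)))))

allScan-cong : ∀ Φ Ψ P Y S → AgreeOn P Y Φ Ψ → allScan Φ P Y S ≡ allScan Ψ P Y S
allScan-cong Φ Ψ P [] S _ = refl
allScan-cong Φ Ψ P (y ∷ Y) S agree =
  cong₂ _∧_ (AgreeOn-head P y Y S agree) (allScan-cong Φ Ψ (P ++ y ∷ []) Y S (AgreeOn-tail P y Y agree))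

selectScan-cong : ∀ h Φ Ψ P Y S → AgreeOn P Y Φ Ψ → selectScan h Φ P Y S ≡ selectScan h Ψ P Y S
selectScan-cong h Φ Ψ P [] S _ = refl
selectScan-cong h Φ Ψ P (y ∷ Y) S agree
  rewrite AgreeOn-head P y Y S agree | selectScan-cong h Φ Ψ (P ++ y ∷ []) Y S (AgreeOn-tail P y Y agree) = refl

allScan-∧ : ∀ Φ Ψ P Y S → allScan (λ i Q w U → Φ i Q w U ∧ Ψ i Q w U) P Y S ≡ allScan Φ P Y S ∧ allScan Ψ P Y S
allScan-∧ Φ Ψ P [] S = refl
allScan-∧ Φ Ψ P (y ∷ Y) S rewrite allScan-∧ Φ Ψ (P ++ y ∷ []) Y S
  with Φ (suc (length P)) P y (Y ++ S) | Ψ (suc (length P)) P y (Y ++ S) | allScan Φ (P ++ y ∷ []) Y S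
... | true | true | _ = refl
... | true | false | true = refl
... | true | false | false = refl
... | false | _ | _ = refl

IgnoresSuffix : Test → Set
IgnoresSuffix Φ = ∀ i P w U U′ → Φ i P w U ≡ Φ i P w U′

allScan-suffix : ∀ Φ → IgnoresSuffix Φ → ∀ P Y S S′ → allScan Φ P Y S ≡ allScan Φ P Y S′
allScan-suffix Φ ign P [] S S′ = refl
allScan-suffix Φ ign P (y ∷ Y) S S′ = cong₂ _∧_ (ign _ _ _ _ _) (allScan-suffix Φ ign (P ++ y ∷ []) Y S S′)

selectScan-suffix : ∀ h Φ → IgnoresSuffix Φ → ∀ P Y S S′ → selectScan h Φ P Y S ≡ selectScan h Φ P Y S′
selectScan-suffix h Φ ign P [] S S′ = refl
selectScan-suffix h Φ ign P (y ∷ Y) S S′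
  rewrite ign (suc (length P)) P y (Y ++ S) (Y ++ S′) | selectScan-suffix h Φ ign (P ++ y ∷ []) Y S S′ = refl

selectScan-false : ∀ h P Y S → selectScan h (λ _ _ _ _ → false) P Y S ≡ []
selectScan-false h P [] S = refl
selectScan-false h P (y ∷ Y) S = selectScan-false h (P ++ y ∷ []) Y S

selectScan-true : ∀ P Y S → selectScan (λ _ w → w) (λ _ _ _ _ → true) P Y S ≡ Y
selectScan-true P [] S = refl
selectScan-true P (y ∷ Y) S = cong (y ∷_) (selectScan-true (P ++ y ∷ []) Y S)

allScan-true : ∀ P Y S → allScan (λ _ _ _ _ → true) P Y S ≡ true
allScan-true P [] S = refl
allScan-true P (y ∷ Y) S = allScan-true (P ++ y ∷ []) Y S

length-selectScan : ∀ h Φ P Y S → length (selectScan h Φ P Y S) ≤ length Y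
length-selectScan h Φ P [] S = z≤n
length-selectScan h Φ P (y ∷ Y) S with Φ (suc (length P)) P y (Y ++ S)
... | true = s≤s (length-selectScan h Φ (P ++ y ∷ []) Y S)
... | false = ≤-trans (length-selectScan h Φ (P ++ y ∷ []) Y S) (n≤1+n _)

newAscent : List ℕ → ℕ → ℕ
newAscent [] y = 0
newAscent (x ∷ []) y = b2n (x <ᵇ y)
newAscent (x ∷ z ∷ P) y = newAscent (z ∷ P) y

asc-++-∷ : ∀ P y Y → asc (P ++ y ∷ Y) ≡ asc P + newAscent P y + asc (y ∷ Y)
asc-++-∷ [] y Y = refl
asc-++-∷ (x ∷ []) y Y rewrite b2n-if (x <ᵇ y) = refl
asc-++-∷ (x ∷ z ∷ P) y Y rewrite asc-++-∷ (z ∷ P) y Y =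
  sym (trans (+-assoc (c + a) n t) (trans (+-assoc c a (n + t)) (cong (c +_) (sym (+-assoc a n t)))))
  where
  c = if x <ᵇ z then 1 else 0
  a = asc (z ∷ P)
  n = newAscent (z ∷ P) y
  t = asc (y ∷ Y)

asc-∷ʳ : ∀ P y → asc (P ++ y ∷ []) ≡ asc P + newAscent P y
asc-∷ʳ P y = trans (asc-++-∷ P y []) (+-identityʳ _)

newAscent-++ : ∀ P y Y z → newAscent (P ++ y ∷ Y) z ≡ newAscent (y ∷ Y) z
newAscent-++ [] y Y z = refl
newAscent-++ (x ∷ []) y Y z = refl
newAscent-++ (x ∷ w ∷ P) y Y z = newAscent-++ (w ∷ P) y Y z

newAscent-∷ʳ : ∀ P y z → newAscent (P ++ y ∷ []) z ≡ b2n (y <ᵇ z)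
newAscent-∷ʳ P y z = newAscent-++ P y [] z

newAscent≤1 : ∀ P y → newAscent P y ≤ 1
newAscent≤1 [] y = z≤n
newAscent≤1 (x ∷ []) y with x <ᵇ y
... | true = ≤-refl
... | false = z≤n
newAscent≤1 (x ∷ z ∷ P) y = newAscent≤1 (z ∷ P) y

newAscent-allGt : ∀ m X → T (allGt m X) → newAscent X m ≡ 0
newAscent-allGt m [] _ = refl
newAscent-allGt m (x ∷ []) h rewrite ≥⇒<ᵇ-false {x} {m} (<⇒≤ (<ᵇ⇒< m x (proj₁ (split-∧ {m <ᵇ x} h)))) = refl
newAscent-allGt m (x ∷ z ∷ X) h = newAscent-allGt m (z ∷ X) (proj₂ (split-∧ {m <ᵇ x} h))

asc-∷-≤ : ∀ x P → asc (x ∷ P) ≤ length P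
asc-∷-≤ x [] = z≤n
asc-∷-≤ x (z ∷ P) with x <ᵇ z
... | true = s≤s (asc-∷-≤ z P)
... | false = ≤-trans (asc-∷-≤ z P) (n≤1+n _)

asc<length : ∀ P → 1 ≤ length P → asc P < length P
asc<length (x ∷ P) _ = s≤s (asc-∷-≤ x P)

asc-++-mono : ∀ P Q → asc P ≤ asc (P ++ Q)
asc-++-mono P [] = ≤-reflexive (cong asc (sym (++-identityʳ P)))
asc-++-mono P (y ∷ Q) rewrite asc-++-∷ P y Q = ≤-trans (m≤m+n (asc P) (newAscent P y)) (m≤m+n _ _)

lastEntry : ℕ → List ℕ → ℕ
lastEntry x [] = x
lastEntry x (y ∷ Q) = lastEntry y Q

lastEntry-∷ʳ : ∀ x A r → lastEntry x (A ++ r ∷ []) ≡ r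
lastEntry-∷ʳ x [] r = refl
lastEntry-∷ʳ x (a ∷ A) r = lastEntry-∷ʳ a A r

all-ascents-grow : ∀ x Q → asc (x ∷ Q) ≡ length Q → x + length Q ≤ lastEntry x Q
all-ascents-grow x [] _ = ≤-reflexive (+-identityʳ x)
all-ascents-grow x (y ∷ Q) e with x <ᵇ y in x<ᵇy
... | true = ≤-trans (≤-reflexive (+-suc x (length Q)))
               (≤-trans (+-monoˡ-≤ (length Q) (<ᵇ⇒< x y (≡true⇒T x<ᵇy))) (all-ascents-grow y Q (suc-injective e)))
... | false = ⊥-elim (<-irrefl refl (subst (_≤ length Q) e (asc-∷-≤ y Q)))

-- If the entry after r is at least r + 2 and still respects the ascent bound, then not every
-- adjacent pair up to r is an ascent (otherwise r would be at least its position).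
asc-deficit : ∀ (A : List ℕ) r x → x ≤ asc (A ++ r ∷ []) + 1 → r + 2 ≤ x → asc (A ++ r ∷ []) < length A
asc-deficit [] r x x≤ r+2≤x = ⊥-elim (<⇒≱ (≤-trans (m≤n+m 2 r) r+2≤x) x≤)
asc-deficit (a ∷ A) r x x≤ r+2≤x with m≤n⇒m<n∨m≡n (subst (asc (a ∷ A ++ r ∷ []) ≤_) (length-∷ʳ A r) (asc-∷-≤ a (A ++ r ∷ [])))
... | inj₁ lt = lt
... | inj₂ all-asc = ⊥-elim (<⇒≱ (≤-trans (≤-trans (≤-reflexive (sym (+-suc (length (a ∷ A)) 1))) (+-monoˡ-≤ 2 A≤r)) r+2≤x)
                               (subst (x ≤_) (cong (_+ 1) all-asc) x≤))
  where
  A≤r : length (a ∷ A) ≤ r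
  A≤r = ≤-trans (≤-trans (≤-reflexive (sym (length-∷ʳ A r))) (m≤n+m _ a))
                (≤-trans (all-ascents-grow a (A ++ r ∷ []) (trans all-asc (sym (length-∷ʳ A r)))) (≤-reflexive (lastEntry-∷ʳ a A r)))

ascentTest : Test
ascentTest i P w U = (w <ᵇ i) ∧ ((i ≤ᵇ 1) ∨ (w ≤ᵇ asc P + 1))

ascentTest-elim : ∀ i P w U → 2 ≤ i → T (ascentTest i P w U) → (w < i) × (w ≤ asc P + 1)
ascentTest-elim i P w U 2≤i h with split-∧ {w <ᵇ i} h
... | w<i , bound = <ᵇ⇒< w i w<i , ≤ᵇ⇒≤ w _ (resolve-∨ {i ≤ᵇ 1} bound (λ t → <⇒≱ 2≤i (≤ᵇ⇒≤ i 1 t)))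

ascentTest-intro : ∀ i P w U → w < i → w ≤ asc P + 1 → T (ascentTest i P w U)
ascentTest-intro i P w U w<i w≤ = pair-∧ {w <ᵇ i} (<⇒<ᵇ w<i) (inj-∨ʳ (≤⇒≤ᵇ w≤))

isAscent≡allScan : ∀ s → isAscent s ≡ allScan ascentTest [] s []
isAscent≡allScan s = trans (cong₂ _∧_ (all-pos≡allScan (λ i P w U → w <ᵇ i) s) (all-pos≡allScan (λ i P w U → (i ≤ᵇ 1) ∨ (w ≤ᵇ asc P + 1)) s))
                           (sym (allScan-∧ (λ i P w U → w <ᵇ i) (λ i P w U → (i ≤ᵇ 1) ∨ (w ≤ᵇ asc P + 1)) [] s []))

allScan-ascent-prefix : ∀ P P′ Y S → length P ≡ length P′ → asc P ≡ asc P′ → (∀ z → newAscent P z ≡ newAscent P′ z) →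
  allScan ascentTest P Y S ≡ allScan ascentTest P′ Y S
allScan-ascent-prefix P P′ [] S _ _ _ = refl
allScan-ascent-prefix P P′ (y ∷ Y) S len asc≡ new≡ rewrite len | asc≡ =
  cong (ascentTest (suc (length P′)) P′ y (Y ++ S) ∧_)
    (allScan-ascent-prefix (P ++ y ∷ []) (P′ ++ y ∷ []) Y S
      (trans (length-∷ʳ P y) (trans (cong suc len) (sym (length-∷ʳ P′ y))))
      (trans (asc-∷ʳ P y) (trans (cong₂ _+_ asc≡ (new≡ y)) (sym (asc-∷ʳ P′ y))))
      (λ z → trans (newAscent-∷ʳ P y z) (sym (newAscent-∷ʳ P′ y z))))

nonMascTest : Test
nonMascTest i P w U = not (w ≡ᵇ asc P + 1)

-- Inserting one entry and one ascent before x turns the bound x ≤ a + 1 into x ≤ a + 2 with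
-- the value a + 2 (an 𝓜asc in the new sequence) excluded.
bound-shift : ∀ x n a → a < suc n →
  ((x <ᵇ suc (suc n)) ∧ (x ≤ᵇ a + 1)) ≡ ((x <ᵇ suc (suc (suc n))) ∧ (x ≤ᵇ suc a + 1)) ∧ not (x ≡ᵇ suc a + 1)
bound-shift x n a a<n = T-extensional to from
  where
  to : T ((x <ᵇ suc (suc n)) ∧ (x ≤ᵇ a + 1)) → T (((x <ᵇ suc (suc (suc n))) ∧ (x ≤ᵇ suc a + 1)) ∧ not (x ≡ᵇ suc a + 1))
  to h with split-∧ {x <ᵇ suc (suc n)} h
  ... | x<n , x≤ = let x≤a+1 = ≤ᵇ⇒≤ x (a + 1) x≤ in
    pair-∧ {(x <ᵇ suc (suc (suc n))) ∧ (x ≤ᵇ suc a + 1)}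
      (pair-∧ {x <ᵇ suc (suc (suc n))} (<⇒<ᵇ (≤-trans (<ᵇ⇒< x _ x<n) (n≤1+n _))) (≤⇒≤ᵇ (≤-trans x≤a+1 (n≤1+n _))))
      (¬T⇒T-not (λ e → <-irrefl refl (≤-trans (≤-reflexive (cong suc (sym (≡ᵇ⇒≡ x _ e)))) (s≤s x≤a+1))))
  from : T (((x <ᵇ suc (suc (suc n))) ∧ (x ≤ᵇ suc a + 1)) ∧ not (x ≡ᵇ suc a + 1)) → T ((x <ᵇ suc (suc n)) ∧ (x ≤ᵇ a + 1))
  from h with split-∧ {(x <ᵇ suc (suc (suc n))) ∧ (x ≤ᵇ suc a + 1)} h
  ... | h₁ , notMasc =
    let x≤a+2 = ≤ᵇ⇒≤ x (suc a + 1) (proj₂ (split-∧ {x <ᵇ suc (suc (suc n))} h₁))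
        x≤a+1 : x ≤ a + 1
        x≤a+1 = ≤-pred (≤∧≢⇒< x≤a+2 (λ e → T-not⇒¬T notMasc (≡⇒≡ᵇ x _ e)))
    in pair-∧ {x <ᵇ suc (suc n)} (<⇒<ᵇ (s≤s (≤-trans x≤a+1 (≤-trans (≤-reflexive (+-comm a 1)) a<n)))) (≤⇒≤ᵇ x≤a+1)

ascentTest-shift : ∀ P P′ x U U′ → length P′ ≡ suc (length P) → asc P′ ≡ suc (asc P) → 1 ≤ length P →
  ascentTest (suc (length P)) P x U ≡ ascentTest (suc (length P′)) P′ x U′ ∧ nonMascTest (suc (length P′)) P′ x U′
ascentTest-shift P P′ x U U′ len asc≡ nonempty rewrite len | asc≡ = shift (length P) (asc P) nonempty (asc<length P nonempty)
  where
  shift : ∀ n a → 1 ≤ n → a < n →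
    (x <ᵇ suc n) ∧ ((suc n ≤ᵇ 1) ∨ (x ≤ᵇ a + 1)) ≡ ((x <ᵇ suc (suc n)) ∧ ((suc (suc n) ≤ᵇ 1) ∨ (x ≤ᵇ suc a + 1))) ∧ not (x ≡ᵇ suc a + 1)
  shift (suc n) a _ a<n = bound-shift x n a a<n

∧-interchange : ∀ a b c l l₁ l₂ → a ≡ b ∧ c → l ≡ l₁ ∧ l₂ → (a ∧ l) ≡ (b ∧ l₁) ∧ (c ∧ l₂)
∧-interchange a true true l l₁ l₂ refl refl = refl
∧-interchange a true false l l₁ l₂ refl refl with l₁
... | true = refl
... | false = refl
∧-interchange a false c l l₁ l₂ refl refl = refl

-- Shifting everything after P by one position and one ascent leaves the ascent condition on X
-- intact exactly when X contains no 𝓜asc of the new sequence.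
allScan-ascent-shift : ∀ m X P P′ S S′ → length P′ ≡ suc (length P) → asc P′ ≡ suc (asc P) → 1 ≤ length P →
  (∀ y → m < y → newAscent P y ≡ newAscent P′ y) → T (allGt m X) →
  allScan ascentTest P X S ≡ allScan ascentTest P′ X S′ ∧ allScan nonMascTest P′ X S′
allScan-ascent-shift m [] P P′ S S′ _ _ _ _ _ = refl
allScan-ascent-shift m (x ∷ X) P P′ S S′ len asc≡ nonempty new≡ m<X =
  ∧-interchange (ascentTest (suc (length P)) P x (X ++ S)) (ascentTest (suc (length P′)) P′ x (X ++ S′)) (nonMascTest (suc (length P′)) P′ x (X ++ S′))
    (allScan ascentTest (P ++ x ∷ []) X S) (allScan ascentTest (P′ ++ x ∷ []) X S′) (allScan nonMascTest (P′ ++ x ∷ []) X S′)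
    (ascentTest-shift P P′ x (X ++ S) (X ++ S′) len asc≡ nonempty)
    (allScan-ascent-shift m X (P ++ x ∷ []) (P′ ++ x ∷ []) S S′
      (trans (length-∷ʳ P′ x) (trans (cong suc len) (cong suc (sym (length-∷ʳ P x)))))
      (trans (asc-∷ʳ P′ x) (trans (cong₂ _+_ asc≡ (sym (new≡ x (<ᵇ⇒< m x (proj₁ (split-∧ {m <ᵇ x} m<X)))))) (cong suc (sym (asc-∷ʳ P x)))))
      (≤-trans (s≤s z≤n) (≤-reflexive (sym (length-∷ʳ P x))))
      (λ y _ → trans (newAscent-∷ʳ P x y) (sym (newAscent-∷ʳ P′ x y)))
      (proj₂ (split-∧ {m <ᵇ x} m<X)))

position : ℕ → ℕ → ℕ
position i w = i

entry : ℕ → ℕ → ℕ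
entry i w = w

fixedPointTest : Test
fixedPointTest i P w U = w ≡ᵇ i ∸ 1

maxs≡selectScan : ∀ s → maxs s ≡ length (selectScan position fixedPointTest [] s [])
maxs≡selectScan s = trans (sym (length-map (λ i → i) (filterᵇ (λ i → at s i ≡ᵇ i ∸ 1) (pos s))))
                          (cong length (map-filter-pos≡selectScan position fixedPointTest s))

deficit-step : ∀ P y U → T (ascentTest (suc (length P)) P y U) → asc P + 1 < length P →
  (y < length P) × (asc (P ++ y ∷ []) + 1 < length (P ++ y ∷ []))
deficit-step P y U h deficit = ≤-trans (s≤s y≤) deficit , deficit′
  where
  y≤ : y ≤ asc P + 1
  y≤ = proj₂ (ascentTest-elim (suc (length P)) P y U (≤-trans (≤-trans (s≤s (m≤n+m 1 (asc P))) deficit) (n≤1+n _)) h)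
  deficit′ : asc (P ++ y ∷ []) + 1 < length (P ++ y ∷ [])
  deficit′ rewrite asc-∷ʳ P y | length-∷ʳ P y =
    s≤s (≤-trans (≤-trans (+-monoˡ-≤ 1 (+-monoʳ-≤ (asc P) (newAscent≤1 P y))) (≤-reflexive (+-comm (asc P + 1) 1))) deficit)

fixedPoints-after-deficit : ∀ P Y S → T (allScan ascentTest P Y S) → asc P + 1 < length P →
  selectScan position fixedPointTest P Y S ≡ []
fixedPoints-after-deficit P [] S _ _ = refl
fixedPoints-after-deficit P (y ∷ Y) S h deficit with split-∧ {ascentTest (suc (length P)) P y (Y ++ S)} h
... | hy , hY with deficit-step P y (Y ++ S) hy deficit
... | y<P , deficit′ rewrite ¬T⇒≡false {y ≡ᵇ length P} (λ t → <-irrefl (≡ᵇ⇒≡ y _ t) y<P) =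
  fixedPoints-after-deficit (P ++ y ∷ []) Y S hY deficit′

no-fixedPoint-after-deficit : ∀ P y Y S → T (allScan ascentTest P (y ∷ Y) S) → asc P + 1 < length P →
  T (allScan fixedPointTest P (y ∷ Y) S) → ⊥
no-fixedPoint-after-deficit P y Y S h deficit fixed =
  <-irrefl (≡ᵇ⇒≡ y _ (proj₁ (split-∧ {fixedPointTest (suc (length P)) P y (Y ++ S)} fixed)))
           (proj₁ (deficit-step P y (Y ++ S) (proj₁ (split-∧ {ascentTest (suc (length P)) P y (Y ++ S)} h)) deficit))

-- rminIdx L M lists the 0-based indices in L of the right-to-left minima of L ++ M lying in L,
-- and rminVal L M their values.

rminIdx : List ℕ → List ℕ → List ℕ
rminIdx [] M = []
rminIdx (x ∷ L) M = if allGt x (L ++ M) then 0 ∷ map suc (rminIdx L M) else map suc (rminIdx L M)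

rminVal : List ℕ → List ℕ → List ℕ
rminVal [] M = []
rminVal (x ∷ L) M = if allGt x (L ++ M) then x ∷ rminVal L M else rminVal L M

rminCount : List ℕ → ℕ
rminCount s = length (rminIdx s [])

rminTest : Test
rminTest i P w U = allGt w U

selectScan-rminTest-position : ∀ P Y S → selectScan position rminTest P Y S ≡ map (λ x → suc (length P + x)) (rminIdx Y S)
selectScan-rminTest-position P [] S = refl
selectScan-rminTest-position P (y ∷ Y) S rewrite selectScan-rminTest-position (P ++ y ∷ []) Y S | length-∷ʳ P y with allGt y (Y ++ S)
... | true = cong₂ _∷_ (cong suc (sym (+-identityʳ (length P)))) shifted
  where
  shifted : map (λ x → suc (suc (length P + x))) (rminIdx Y S) ≡ map (λ x → suc (length P + x)) (map suc (rminIdx Y S))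
  shifted = trans (map-cong (λ x → cong suc (sym (+-suc (length P) x))) (rminIdx Y S)) (map-∘ (rminIdx Y S))
... | false = trans (map-cong (λ x → cong suc (sym (+-suc (length P) x))) (rminIdx Y S)) (map-∘ (rminIdx Y S))

selectScan-rminTest-entry : ∀ P Y S → selectScan entry rminTest P Y S ≡ rminVal Y S
selectScan-rminTest-entry P [] S = refl
selectScan-rminTest-entry P (y ∷ Y) S rewrite selectScan-rminTest-entry (P ++ y ∷ []) Y S with allGt y (Y ++ S)
... | true = refl
... | false = refl

Prm≡rminIdx : ∀ s → Prm s ≡ map suc (rminIdx s [])
Prm≡rminIdx s = trans (sym (map-id (Prm s))) (trans (map-filter-pos≡selectScan position rminTest s) (selectScan-rminTest-position [] s []))

Rmin≡rminVal : ∀ s → Rmin s ≡ rminVal s []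
Rmin≡rminVal s = trans (map-filter-pos≡selectScan entry rminTest s) (selectScan-rminTest-entry [] s [])

rmin≡rminCount : ∀ s → rmin s ≡ rminCount s
rmin≡rminCount s rewrite Prm≡rminIdx s = length-map suc (rminIdx s [])

length-rminVal : ∀ L M → length (rminVal L M) ≡ length (rminIdx L M)
length-rminVal [] M = refl
length-rminVal (x ∷ L) M with allGt x (L ++ M)
... | true = cong suc (trans (length-rminVal L M) (sym (length-map suc (rminIdx L M))))
... | false = trans (length-rminVal L M) (sym (length-map suc (rminIdx L M)))

length-rminIdx-≤ : ∀ L M → length (rminIdx L M) ≤ length L
length-rminIdx-≤ [] M = z≤n
length-rminIdx-≤ (x ∷ L) M with allGt x (L ++ M)
... | true rewrite length-map suc (rminIdx L M) = s≤s (length-rminIdx-≤ L M)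
... | false rewrite length-map suc (rminIdx L M) = ≤-trans (length-rminIdx-≤ L M) (n≤1+n _)

rminIdx-++ : ∀ L₁ L₂ M → rminIdx (L₁ ++ L₂) M ≡ rminIdx L₁ (L₂ ++ M) ++ map (length L₁ +_) (rminIdx L₂ M)
rminIdx-++ [] L₂ M = sym (map-id (rminIdx L₂ M))
rminIdx-++ (x ∷ L₁) L₂ M
  rewrite ++-assoc L₁ L₂ M | rminIdx-++ L₁ L₂ M | map-++ suc (rminIdx L₁ (L₂ ++ M)) (map (length L₁ +_) (rminIdx L₂ M))
        | sym (map-∘ {g = suc} {f = length L₁ +_} (rminIdx L₂ M))
  with allGt x (L₁ ++ L₂ ++ M)
... | true = refl
... | false = refl

rminVal-++ : ∀ L₁ L₂ M → rminVal (L₁ ++ L₂) M ≡ rminVal L₁ (L₂ ++ M) ++ rminVal L₂ M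
rminVal-++ [] L₂ M = refl
rminVal-++ (x ∷ L₁) L₂ M rewrite ++-assoc L₁ L₂ M | rminVal-++ L₁ L₂ M with allGt x (L₁ ++ L₂ ++ M)
... | true = refl
... | false = refl

rminIdx-cong : ∀ L M M′ → (∀ x → allGt x M ≡ allGt x M′) → rminIdx L M ≡ rminIdx L M′
rminIdx-cong [] M M′ _ = refl
rminIdx-cong (x ∷ L) M M′ same
  rewrite all-++ (λ y → x <ᵇ y) L M | all-++ (λ y → x <ᵇ y) L M′ | same x | rminIdx-cong L M M′ same = refl

rminIdx-below : ∀ L m M → T (allGe m L) → rminIdx L (m ∷ M) ≡ []
rminIdx-below [] m M _ = refl
rminIdx-below (x ∷ L) m M m≤L with split-∧ m≤L
... | m≤x , m≤L′ rewrite rminIdx-below L m M m≤L′ | all-++ (λ y → x <ᵇ y) L (m ∷ M)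
                        | ≥⇒<ᵇ-false {x} {m} (≤ᵇ⇒≤ m x m≤x) | ∧-zeroʳ (allGt x L) = refl

at0-++ : ∀ V W j → at0 (V ++ W) (length V + j) ≡ at0 W j
at0-++ [] W j = refl
at0-++ (x ∷ V) W j = at0-++ V W j

at0-++ˡ : ∀ V W j → j < length V → at0 (V ++ W) j ≡ at0 V j
at0-++ˡ (x ∷ V) W zero _ = refl
at0-++ˡ (x ∷ V) W (suc j) (s≤s j<V) = at0-++ˡ V W j j<V

at0-map : ∀ (f : ℕ → ℕ) l j → j < length l → at0 (map f l) j ≡ f (at0 l j)
at0-map f (x ∷ l) zero _ = refl
at0-map f (x ∷ l) (suc j) (s≤s j<l) = at0-map f l j j<l

rminIdx-< : ∀ L M j → j < length (rminIdx L M) → at0 (rminIdx L M) j < length L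
rminIdx-< (x ∷ L) M j j< with allGt x (L ++ M)
rminIdx-< (x ∷ L) M zero j< | true = s≤s z≤n
rminIdx-< (x ∷ L) M (suc j) (s≤s j<) | true rewrite at0-map suc (rminIdx L M) j (subst (j <_) (length-map suc (rminIdx L M)) j<) =
  s≤s (rminIdx-< L M j (subst (j <_) (length-map suc (rminIdx L M)) j<))
rminIdx-< (x ∷ L) M j j< | false rewrite at0-map suc (rminIdx L M) j (subst (j <_) (length-map suc (rminIdx L M)) j<) =
  s≤s (rminIdx-< L M j (subst (j <_) (length-map suc (rminIdx L M)) j<))

rminIdx-split : ∀ L v R → T (allGt v R) →
  rminIdx (L ++ v ∷ R) [] ≡ rminIdx L (v ∷ R) ++ length L ∷ map (λ x → suc (length L + x)) (rminIdx R [])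
rminIdx-split L v R v<R rewrite rminIdx-++ L (v ∷ R) [] | ++-identityʳ R | T⇒≡true v<R =
  cong (rminIdx L (v ∷ R) ++_) (cong₂ _∷_ (+-identityʳ (length L))
    (trans (sym (map-∘ (rminIdx R []))) (map-cong (λ x → +-suc (length L) x) (rminIdx R []))))

rminVal-split : ∀ L v R → T (allGt v R) → rminVal (L ++ v ∷ R) [] ≡ rminVal L (v ∷ R) ++ v ∷ rminVal R []
rminVal-split L v R v<R rewrite rminVal-++ L (v ∷ R) [] | ++-identityʳ R | T⇒≡true v<R = refl

occAfterTest : ℕ → ℕ → Test
occAfterTest v p i P w U = (p <ᵇ i) ∧ (w ≡ᵇ v)

length-selectScan-occAfter-≤ : ∀ v q P Y S → q ≤ length P → length (selectScan position (occAfterTest v q) P Y S) ≡ occ v Y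
length-selectScan-occAfter-≤ v q P [] S _ = refl
length-selectScan-occAfter-≤ v q P (y ∷ Y) S q≤P rewrite occ-∷ v y Y | T⇒≡true (<⇒<ᵇ (s≤s q≤P)) with y ≡ᵇ v
... | true = cong suc (length-selectScan-occAfter-≤ v q (P ++ y ∷ []) Y S q≤P′)
  where q≤P′ = ≤-trans q≤P (≤-trans (n≤1+n _) (≤-reflexive (sym (length-∷ʳ P y))))
... | false = length-selectScan-occAfter-≤ v q (P ++ y ∷ []) Y S (≤-trans q≤P (≤-trans (n≤1+n _) (≤-reflexive (sym (length-∷ʳ P y)))))

length-selectScan-occAfter : ∀ v p P Y S → length (selectScan position (occAfterTest v (length P + p)) P Y S) ≡ occ v (drop p Y)
length-selectScan-occAfter v zero P Y S rewrite +-identityʳ (length P) = length-selectScan-occAfter-≤ v (length P) P Y S ≤-refl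
length-selectScan-occAfter v (suc p) P [] S = refl
length-selectScan-occAfter v (suc p) P (y ∷ Y) S
  rewrite ≥⇒<ᵇ-false {length P + suc p} {suc (length P)} (m<m+n (length P) z<s) =
  trans (cong (λ t → length (selectScan position (occAfterTest v t) (P ++ y ∷ []) Y S)) shift)
        (length-selectScan-occAfter v p (P ++ y ∷ []) Y S)
  where
  shift : length P + suc p ≡ length (P ++ y ∷ []) + p
  shift rewrite length-∷ʳ P y = +-suc (length P) p

occAfter≡occ-drop : ∀ s v p → occAfter s v p ≡ occ v (drop p s)
occAfter≡occ-drop s v p =
  trans (sym (length-map (λ i → i) (filterᵇ (λ i → (p <ᵇ i) ∧ (at s i ≡ᵇ v)) (pos s))))
        (trans (cong length (map-filter-pos≡selectScan position (occAfterTest v p) s)) (length-selectScan-occAfter v p [] s []))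

drop-∷ : ∀ (L : List ℕ) v R → drop (suc (length L)) (L ++ v ∷ R) ≡ R
drop-∷ [] v R = refl
drop-∷ (x ∷ L) v R = drop-∷ L v R

drop-∷-+ : ∀ (L : List ℕ) v R a → drop (suc (suc (length L + a))) (L ++ v ∷ R) ≡ drop (suc a) R
drop-∷-+ [] v R a = refl
drop-∷-+ (x ∷ L) v R a = drop-∷-+ L v R a

PrmAt≡suc-rminIdx : ∀ R j → j < rminCount R → PrmAt R j ≡ suc (at0 (rminIdx R []) j)
PrmAt≡suc-rminIdx R j j<R rewrite Prm≡rminIdx R = at0-map suc (rminIdx R []) j j<R

-- c is the index of v among the right-to-left minima of s = L ++ v ∷ R.
module RminSplit (L : List ℕ) (v : ℕ) (R : List ℕ) (v<R : T (allGt v R)) where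
  s = L ++ v ∷ R
  c = length (rminIdx L (v ∷ R))

  private
    V = rminVal L (v ∷ R)
    I = map suc (rminIdx L (v ∷ R))
    I′ = map suc (map (λ x → suc (length L + x)) (rminIdx R []))

    Rmin-s : Rmin s ≡ V ++ v ∷ rminVal R []
    Rmin-s = trans (Rmin≡rminVal s) (rminVal-split L v R v<R)

    V-shift : ∀ j → c + j ≡ length V + j
    V-shift j = cong (_+ j) (sym (length-rminVal L (v ∷ R)))

    I-shift : ∀ j → c + j ≡ length I + j
    I-shift j = cong (_+ j) (sym (length-map suc (rminIdx L (v ∷ R))))

  RminAt-here : RminAt s c ≡ v
  RminAt-here = begin
    at0 (Rmin s) c                          ≡⟨ cong (λ l → at0 l c) Rmin-s ⟩
    at0 (V ++ v ∷ rminVal R []) c           ≡⟨ cong (at0 (V ++ v ∷ rminVal R [])) (trans (sym (+-identityʳ c)) (V-shift 0)) ⟩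
    at0 (V ++ v ∷ rminVal R []) (length V + 0) ≡⟨ at0-++ V (v ∷ rminVal R []) 0 ⟩
    v ∎
    where open ≡-Reasoning

  RminAt-after : ∀ j → RminAt s (suc (c + j)) ≡ RminAt R j
  RminAt-after j = begin
    at0 (Rmin s) (suc (c + j))              ≡⟨ cong (λ l → at0 l (suc (c + j))) Rmin-s ⟩
    at0 (V ++ v ∷ rminVal R []) (suc (c + j)) ≡⟨ cong (at0 (V ++ v ∷ rminVal R [])) (trans (sym (+-suc c j)) (V-shift (suc j))) ⟩
    at0 (V ++ v ∷ rminVal R []) (length V + suc j) ≡⟨ at0-++ V (v ∷ rminVal R []) (suc j) ⟩
    at0 (rminVal R []) j                    ≡⟨ cong (λ l → at0 l j) (sym (Rmin≡rminVal R)) ⟩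
    RminAt R j ∎
    where open ≡-Reasoning

  rminIdx-s : rminIdx s [] ≡ rminIdx L (v ∷ R) ++ length L ∷ map (λ x → suc (length L + x)) (rminIdx R [])
  rminIdx-s = rminIdx-split L v R v<R

  Prm-s : Prm s ≡ I ++ suc (length L) ∷ I′
  Prm-s = trans (Prm≡rminIdx s) (trans (cong (map suc) rminIdx-s) (map-++ suc (rminIdx L (v ∷ R)) _))

  PrmAt-here : PrmAt s c ≡ suc (length L)
  PrmAt-here rewrite Prm-s = trans (cong (at0 (I ++ suc (length L) ∷ I′)) (trans (sym (+-identityʳ c)) (I-shift 0))) (at0-++ I _ 0)

  PrmAt-after : ∀ j → j < rminCount R → PrmAt s (suc (c + j)) ≡ suc (suc (length L + at0 (rminIdx R []) j))
  PrmAt-after j j<R rewrite Prm-s = begin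
    at0 (I ++ suc (length L) ∷ I′) (suc (c + j))         ≡⟨ cong (at0 (I ++ suc (length L) ∷ I′)) (trans (sym (+-suc c j)) (I-shift (suc j))) ⟩
    at0 (I ++ suc (length L) ∷ I′) (length I + suc j)    ≡⟨ at0-++ I (suc (length L) ∷ I′) (suc j) ⟩
    at0 I′ j                                             ≡⟨ at0-map suc (map (λ x → suc (length L + x)) (rminIdx R [])) j (subst (j <_) (sym (length-map (λ x → suc (length L + x)) (rminIdx R []))) j<R) ⟩
    suc (at0 (map (λ x → suc (length L + x)) (rminIdx R [])) j) ≡⟨ cong suc (at0-map (λ x → suc (length L + x)) (rminIdx R []) j j<R) ⟩
    suc (suc (length L + at0 (rminIdx R []) j)) ∎
    where open ≡-Reasoning

  rminCount-s : rminCount s ≡ c + suc (rminCount R)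
  rminCount-s rewrite rminIdx-s = trans (length-++ (rminIdx L (v ∷ R))) (cong (c +_) (cong suc (length-map _ (rminIdx R []))))

  qualifies-after : ∀ j → j < rminCount R → qualifies s (suc (c + j)) ≡ qualifies R j
  qualifies-after zero j<R
    rewrite RminAt-after 0 | +-identityʳ c | PrmAt-here
          | occAfter≡occ-drop s (RminAt R 0) (suc (length L)) | drop-∷ L v R | occAfter≡occ-drop R (RminAt R 0) 0 = refl
  qualifies-after (suc j) j<R
    rewrite RminAt-after (suc j) | +-suc c j | PrmAt-after j (≤-trans (n≤1+n _) j<R) | PrmAt≡suc-rminIdx R j (≤-trans (n≤1+n _) j<R)
          | occAfter≡occ-drop s (RminAt R (suc j)) (suc (suc (length L + at0 (rminIdx R []) j)))
          | drop-∷-+ L v R (at0 (rminIdx R []) j)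
          | occAfter≡occ-drop R (RminAt R (suc j)) (suc (at0 (rminIdx R []) j)) = refl

rminCount≤length : ∀ s → rminCount s ≤ length s
rminCount≤length s = length-rminIdx-≤ s []

record MinimumSplit (s : List ℕ) (j : ℕ) : Set where
  constructor minimumSplit
  field
    L : List ℕ
    v : ℕ
    R : List ℕ
    shape : s ≡ L ++ v ∷ R
    v<R : T (allGt v R)
    index : length (rminIdx L (v ∷ R)) ≡ j

  RminAt-index : RminAt s j ≡ v
  RminAt-index rewrite shape | sym index = RminSplit.RminAt-here L v R v<R

  PrmAt-index : PrmAt s j ≡ suc (length L)
  PrmAt-index rewrite shape | sym index = RminSplit.PrmAt-here L v R v<R

minimumSplit-at : ∀ s j → j < rminCount s → MinimumSplit s j
minimumSplit-at (x ∷ xs) j j< with allGt x (xs ++ []) in x<xs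
minimumSplit-at (x ∷ xs) zero j< | true = minimumSplit [] x xs refl (subst (λ l → T (allGt x l)) (++-identityʳ xs) (≡true⇒T x<xs)) refl
minimumSplit-at (x ∷ xs) (suc j) (s≤s j<) | true with minimumSplit-at xs j (subst (j <_) (length-map suc (rminIdx xs [])) j<)
... | minimumSplit L v R refl v<R index = minimumSplit (x ∷ L) v R refl v<R index′
  where
  index′ : length (rminIdx (x ∷ L) (v ∷ R)) ≡ suc j
  index′ rewrite ++-identityʳ (L ++ v ∷ R) | x<xs = cong suc (trans (length-map suc (rminIdx L (v ∷ R))) index)
minimumSplit-at (x ∷ xs) j j< | false with minimumSplit-at xs j (subst (j <_) (length-map suc (rminIdx xs [])) j<)
... | minimumSplit L v R refl v<R index = minimumSplit (x ∷ L) v R refl v<R index′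
  where
  index′ : length (rminIdx (x ∷ L) (v ∷ R)) ≡ j
  index′ rewrite ++-identityʳ (L ++ v ∷ R) | x<xs = trans (length-map suc (rminIdx L (v ∷ R))) index

≤-some-later : ∀ m x l → T (allGe m l) → (T (allGt x l) → ⊥) → m ≤ x
≤-some-later m x [] _ ¬x<l = ⊥-elim (¬x<l tt)
≤-some-later m x (y ∷ l) m≤l ¬x<l with x <ᵇ y in x<ᵇy
... | true = ≤-some-later m x l (proj₂ (split-∧ {m ≤ᵇ y} m≤l)) ¬x<l
... | false = ≤-trans (≤ᵇ⇒≤ m y (proj₁ (split-∧ {m ≤ᵇ y} m≤l))) (≮⇒≥ (λ lt → subst T x<ᵇy (<⇒<ᵇ lt)))

Rmin₀-minimum : ∀ x l → T (allGe (at0 (rminVal (x ∷ l) []) 0) (x ∷ l))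
Rmin₀-minimum x l with allGt x (l ++ []) in x<l
... | true = pair-∧ {x ≤ᵇ x} (≤⇒≤ᵇ (≤-refl {x})) (allGt⇒allGe x l (subst (λ z → T (allGt x z)) (++-identityʳ l) (≡true⇒T x<l)))
Rmin₀-minimum x [] | false = ⊥-elim (subst T x<l tt)
Rmin₀-minimum x (y ∷ l) | false =
  pair-∧ {at0 (rminVal (y ∷ l) []) 0 ≤ᵇ x}
    (≤⇒≤ᵇ (≤-some-later (at0 (rminVal (y ∷ l) []) 0) x (y ∷ l) (Rmin₀-minimum y l) (λ t → subst T x<l (subst (λ z → T (allGt x z)) (sym (++-identityʳ (y ∷ l))) t))))
    (Rmin₀-minimum y l)

all-≥0 : ∀ l → T (allGe 0 l)
all-≥0 [] = tt
all-≥0 (x ∷ l) = all-≥0 l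

Rmin₀-ascent : ∀ s → T (isAscent s) → RminAt s 0 ≡ 0
Rmin₀-ascent [] _ = refl
Rmin₀-ascent (y ∷ rest) h = n≤0⇒n≡0 (subst (RminAt (y ∷ rest) 0 ≤_) y≡0 Rmin₀≤y)
  where
  y≡0 : y ≡ 0
  y≡0 = n<1⇒n≡0 (<ᵇ⇒< y 1 (proj₁ (split-∧ {y <ᵇ 1} (proj₁ (split-∧ {ascentTest 1 [] y (rest ++ [])} (subst T (isAscent≡allScan (y ∷ rest)) h))))))
  Rmin₀≤y : RminAt (y ∷ rest) 0 ≤ y
  Rmin₀≤y = subst (_≤ y) (sym (cong (λ l → at0 l 0) (Rmin≡rminVal (y ∷ rest))))
                  (≤ᵇ⇒≤ _ y (proj₁ (split-∧ {at0 (rminVal (y ∷ rest) []) 0 ≤ᵇ y} (Rmin₀-minimum y rest))))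

valueTest : ℕ → Test
valueTest v i P w U = w ≡ᵇ v

occPositions≡selectScan : ∀ s v → occPositions s v ≡ selectScan position (valueTest v) [] s []
occPositions≡selectScan s v = trans (sym (map-id (occPositions s v))) (map-filter-pos≡selectScan position (valueTest v) s)

selectScan-value-∉ : ∀ v P Y S → v ∉ Y → selectScan position (valueTest v) P Y S ≡ []
selectScan-value-∉ v P [] S _ = refl
selectScan-value-∉ v P (y ∷ Y) S v∉ with y ≡ᵇ v
... | false = selectScan-value-∉ v (P ++ y ∷ []) Y S v∉

selectScan-value-hit : ∀ v P Y S → selectScan position (valueTest v) P (v ∷ Y) S ≡ suc (length P) ∷ selectScan position (valueTest v) (P ++ v ∷ []) Y S
selectScan-value-hit v P Y S rewrite ≡ᵇ-refl v = refl

occPositions-prefix : ∀ v L S → selectScan position (valueTest v) [] L S ≡ occPositions L v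
occPositions-prefix v L S = trans (selectScan-suffix position (valueTest v) (λ _ _ _ _ _ → refl) [] L S []) (sym (occPositions≡selectScan L v))

occPositions-last-two : ∀ v A Y Z → v ∉ Y → v ∉ Z →
  occPositions (A ++ v ∷ Y ++ v ∷ Z) v ≡ occPositions A v ++ suc (length A) ∷ suc (length ((A ++ v ∷ []) ++ Y)) ∷ []
occPositions-last-two v A Y Z v∉Y v∉Z
  rewrite occPositions≡selectScan (A ++ v ∷ Y ++ v ∷ Z) v | selectScan-++ position (valueTest v) [] A (v ∷ Y ++ v ∷ Z) []
        | selectScan-value-hit v A (Y ++ v ∷ Z) [] | selectScan-++ position (valueTest v) (A ++ v ∷ []) Y (v ∷ Z) []
        | selectScan-value-∉ v (A ++ v ∷ []) Y (v ∷ Z ++ []) v∉Y | selectScan-value-hit v ((A ++ v ∷ []) ++ Y) Z []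
        | selectScan-value-∉ v (((A ++ v ∷ []) ++ Y) ++ v ∷ []) Z [] v∉Z | occPositions-prefix v A ((v ∷ Y ++ v ∷ Z) ++ []) = refl

occPositions-last : ∀ v L R → v ∉ R → occPositions (L ++ v ∷ R) v ≡ occPositions L v ++ suc (length L) ∷ []
occPositions-last v L R v∉R
  rewrite occPositions≡selectScan (L ++ v ∷ R) v | selectScan-++ position (valueTest v) [] L (v ∷ R) []
        | selectScan-value-hit v L R [] | selectScan-value-∉ v (L ++ v ∷ []) R [] v∉R | occPositions-prefix v L (v ∷ R ++ []) = refl

occPositions-∉ : ∀ v s → v ∉ s → occPositions s v ≡ []
occPositions-∉ v s v∉s = trans (occPositions≡selectScan s v) (selectScan-value-∉ v [] s [] v∉s)

lastTwo-∷ʳ : ∀ (O : List ℕ) a b → lastTwo (O ++ a ∷ b ∷ []) ≡ just (a , b)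
lastTwo-∷ʳ O a b rewrite reverse-++ O (a ∷ b ∷ []) = refl

lastOf-∷ʳ : ∀ (O : List ℕ) a → lastOf (O ++ a ∷ []) ≡ a
lastOf-∷ʳ O a rewrite reverse-++ O (a ∷ []) = refl

lastTwoPositions : ∀ v A Y Z → v ∉ Y → v ∉ Z →
  lastTwo (occPositions (A ++ v ∷ Y ++ v ∷ Z) v) ≡ just (suc (length A) , suc (length ((A ++ v ∷ []) ++ Y)))
lastTwoPositions v A Y Z v∉Y v∉Z = trans (cong lastTwo (occPositions-last-two v A Y Z v∉Y v∉Z)) (lastTwo-∷ʳ (occPositions A v) _ _)

lastPosition : ∀ v L R → v ∉ R → lastOf (occPositions (L ++ v ∷ R) v) ≡ suc (length L)
lastPosition v L R v∉R = trans (cong lastOf (occPositions-last v L R v∉R)) (lastOf-∷ʳ (occPositions L v) _)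

data LastTwoOccurrences (v : ℕ) (s : List ℕ) : Set where
  fewer : lastTwo (occPositions s v) ≡ nothing → LastTwoOccurrences v s
  last-two : ∀ A Y Z → s ≡ A ++ v ∷ Y ++ v ∷ Z → v ∉ Y → v ∉ Z → LastTwoOccurrences v s

lastTwoOccurrences : ∀ v s → LastTwoOccurrences v s
lastTwoOccurrences v s with lastOccurrence v s
... | absent v∉s = fewer (cong lastTwo (occPositions-∉ v s v∉s))
... | last-at L R refl v∉R with lastOccurrence v L
... | last-at A Y refl v∉Y = last-two A Y R (++-assoc A (v ∷ Y) (v ∷ R)) v∉Y v∉R
... | absent v∉L = fewer (cong lastTwo (trans (occPositions-last v L R v∉R) (cong (_++ suc (length L) ∷ []) (occPositions-∉ v L v∉L))))

betweenTest : ℕ → ℕ → Test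
betweenTest p q i P w U = (p <ᵇ i) ∧ (i <ᵇ q)

maskedMascTest : ℕ → ℕ → Test
maskedMascTest p q i P w U = not (betweenTest p q i P w U) ∨ nonMascTest i P w U

module LastTwoGap (A : List ℕ) (v : ℕ) (Y Z : List ℕ) where
  s = A ++ v ∷ Y ++ v ∷ Z
  p = suc (length A)
  q = suc (length ((A ++ v ∷ []) ++ Y))
  A′ = A ++ v ∷ []
  A″ = (A′ ++ Y) ++ v ∷ []

  inside-A : ∀ i → i ≤ length A → (p <ᵇ i) ≡ false
  inside-A i i≤A = ≥⇒<ᵇ-false (≤-trans i≤A (n≤1+n _))

  inside-Y : ∀ i → suc (length A′) ≤ i → i ≤ length A′ + length Y → betweenTest p q i [] 0 [] ≡ true
  inside-Y i lo hi rewrite length-∷ʳ A v | T⇒≡true (<⇒<ᵇ {p} {i} lo)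
    | T⇒≡true (<⇒<ᵇ {i} {q} (s≤s (subst (i ≤_) (sym (trans (length-++ A′) (cong (_+ length Y) (length-∷ʳ A v)))) hi))) = refl

  after-Y : ∀ i → suc (length A″) ≤ i → (i <ᵇ q) ≡ false
  after-Y i lo rewrite length-∷ʳ (A′ ++ Y) v = ≥⇒<ᵇ-false (≤-trans (n≤1+n _) lo)

  q≮q : (q <ᵇ q) ≡ false
  q≮q = ≥⇒<ᵇ-false {q} ≤-refl

  p≮p : (length A <ᵇ length A) ≡ false
  p≮p = ≥⇒<ᵇ-false {length A} ≤-refl

  entries-between : selectScan entry (betweenTest p q) [] s [] ≡ Y
  entries-between
    rewrite selectScan-++ entry (betweenTest p q) [] A (v ∷ Y ++ v ∷ Z) []
          | selectScan-cong entry (betweenTest p q) (λ _ _ _ _ → false) [] A ((v ∷ Y ++ v ∷ Z) ++ [])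
              (λ i Q w U _ hi → cong (_∧ (i <ᵇ q)) (inside-A i hi))
          | selectScan-false entry [] A ((v ∷ Y ++ v ∷ Z) ++ []) | p≮p
          | selectScan-++ entry (betweenTest p q) A′ Y (v ∷ Z) []
          | selectScan-cong entry (betweenTest p q) (λ _ _ _ _ → true) A′ Y (v ∷ Z ++ []) (λ i Q w U lo hi → inside-Y i lo hi)
          | selectScan-true A′ Y (v ∷ Z ++ []) | q≮q | ∧-zeroʳ (length A <ᵇ length (A′ ++ Y))
          | selectScan-cong entry (betweenTest p q) (λ _ _ _ _ → false) A″ Z [] (λ i Q w U lo _ → trans (cong ((p <ᵇ i) ∧_) (after-Y i lo)) (∧-zeroʳ _))
          | selectScan-false entry A″ Z [] = ++-identityʳ Y

  no-Masc-between : allScan (maskedMascTest p q) [] s [] ≡ allScan nonMascTest A′ Y (v ∷ Z ++ [])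
  no-Masc-between
    rewrite allScan-++ (maskedMascTest p q) [] A (v ∷ Y ++ v ∷ Z) []
          | allScan-cong (maskedMascTest p q) (λ _ _ _ _ → true) [] A ((v ∷ Y ++ v ∷ Z) ++ [])
              (λ i Q w U _ hi → cong (λ b → not (b ∧ (i <ᵇ q)) ∨ nonMascTest i Q w U) (inside-A i hi))
          | allScan-true [] A ((v ∷ Y ++ v ∷ Z) ++ []) | p≮p
          | allScan-++ (maskedMascTest p q) A′ Y (v ∷ Z) []
          | allScan-cong (maskedMascTest p q) nonMascTest A′ Y (v ∷ Z ++ []) (λ i Q w U lo hi → cong (λ b → not b ∨ nonMascTest i Q w U) (inside-Y i lo hi))
          | q≮q | ∧-zeroʳ (length A <ᵇ length (A′ ++ Y))
          | allScan-cong (maskedMascTest p q) (λ _ _ _ _ → true) A″ Z []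
              (λ i Q w U lo _ → cong (λ b → not b ∨ nonMascTest i Q w U) (trans (cong ((p <ᵇ i) ∧_) (after-Y i lo)) (∧-zeroʳ _)))
          | allScan-true A″ Z []
    with allScan nonMascTest A′ Y (v ∷ Z ++ [])
  ... | true = refl
  ... | false = refl

entries-between≡selectScan : ∀ s p q → map (at s) (between s p q) ≡ selectScan entry (betweenTest p q) [] s []
entries-between≡selectScan s p q = map-filter-pos≡selectScan entry (betweenTest p q) s

no-Masc-between≡allScan : ∀ s p q → all (λ i → not (isMasc s i)) (between s p q) ≡ allScan (maskedMascTest p q) [] s []
no-Masc-between≡allScan s p q =
  trans (all-filterᵇ (λ i → not (isMasc s i)) (λ i → (p <ᵇ i) ∧ (i <ᵇ q)) (pos s)) (all-pos≡allScan (maskedMascTest p q) s)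

<-minList⇒allGt : ∀ x y Y → x < minList (y ∷ Y) → T (allGt x (y ∷ Y))
<-minList⇒allGt x y Y = go Y
  where
  go : ∀ Y → x < foldr _⊓_ y Y → T (allGt x (y ∷ Y))
  go [] x<y = pair-∧ {x <ᵇ y} (<⇒<ᵇ x<y) tt
  go (z ∷ Y) x< with split-∧ {x <ᵇ y} (go Y (m<n⊓o⇒m<o z _ x<))
  ... | x<y , x<Y = pair-∧ {x <ᵇ y} x<y (pair-∧ {x <ᵇ z} (<⇒<ᵇ (m<n⊓o⇒m<n z _ x<)) x<Y)

allGt⇒<-minList : ∀ x y Y → T (allGt x (y ∷ Y)) → x < minList (y ∷ Y)
allGt⇒<-minList x y Y = go Y
  where
  go : ∀ Y → T (allGt x (y ∷ Y)) → x < foldr _⊓_ y Y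
  go [] h = <ᵇ⇒< x y (proj₁ (split-∧ {x <ᵇ y} h))
  go (z ∷ Y) h with split-∧ {x <ᵇ y} h
  ... | x<y , x<zY with split-∧ {x <ᵇ z} x<zY
  ... | x<z , x<Y = ⊓-pres-m< (<ᵇ⇒< x z x<z) (go Y (pair-∧ {x <ᵇ y} x<y x<Y))

rposOccurrences : List ℕ → Maybe (ℕ × ℕ)
rposOccurrences s = lastTwo (occPositions s (RminAt s (rpos s)))

sebr-just : ∀ s p q → rposOccurrences s ≡ just (p , q) → sebr s ≡ minList (map (at s) (between s p q))
sebr-just s p q e with lastTwo (occPositions s (RminAt s (rpos s)))
sebr-just s p q refl | .(just (p , q)) = refl

sebr-nothing : ∀ s → rposOccurrences s ≡ nothing → sebr s ≡ 0
sebr-nothing s e with lastTwo (occPositions s (RminAt s (rpos s)))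
sebr-nothing s refl | .nothing = refl

condA-just : ∀ s p q → rposOccurrences s ≡ just (p , q) → condA s ≡ (lastOf (occPositions s (RminAt s (rpos s ∸ 1))) + 1 ≡ᵇ p)
condA-just s p q e with lastTwo (occPositions s (RminAt s (rpos s)))
condA-just s p q refl | .(just (p , q)) = refl

condB-just : ∀ s p q → rposOccurrences s ≡ just (p , q) → condB s ≡ ((p + 1 <ᵇ q) ∧ all (λ i → not (isMasc s i)) (between s p q))
condB-just s p q e with lastTwo (occPositions s (RminAt s (rpos s)))
condB-just s p q refl | .(just (p , q)) = refl

condB-nothing : ∀ s → rposOccurrences s ≡ nothing → condB s ≡ false
condB-nothing s e with lastTwo (occPositions s (RminAt s (rpos s)))
condB-nothing s refl | .nothing = refl

rpos≡lastBelow : ∀ s → (rmin s ≡ length s → ⊥) → rpos s ≡ lastBelow (qualifies s) (rmin s)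
rpos≡lastBelow s rmin≢ rewrite ¬T⇒≡false {rmin s ≡ᵇ length s} (λ t → rmin≢ (≡ᵇ⇒≡ _ _ t)) = refl

rpos≡suc⇒lastBelow : ∀ s K → rpos s ≡ suc K → lastBelow (qualifies s) (rmin s) ≡ suc K
rpos≡suc⇒lastBelow s K e with rmin s ≡ᵇ length s
... | false = e

memberᵇ : ℕ → List ℕ → Bool
memberᵇ x [] = false
memberᵇ x (y ∷ l) = (y ≡ᵇ x) ∨ memberᵇ x l

distinctIn : List ℕ → List ℕ → ℕ
distinctIn [] M = 0
distinctIn (x ∷ L) M = (if memberᵇ x (L ++ M) then 0 else 1) + distinctIn L M

distinctCount : List ℕ → ℕ
distinctCount [] = 0
distinctCount (x ∷ xs) = (if memberᵇ x xs then 0 else 1) + distinctCount xs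

dedup : List ℕ → List ℕ
dedup = deduplicateᵇ _≡ᵇ_

filter-does : ∀ {P : ℕ → Set} (P? : Decidable P) l → filter P? l ≡ filterᵇ (λ y → does (P? y)) l
filter-does P? [] = refl
filter-does P? (x ∷ l) with does (P? x)
... | true = cong (x ∷_) (filter-does P? l)
... | false = filter-does P? l

dedup-∷ : ∀ x xs → dedup (x ∷ xs) ≡ x ∷ filterᵇ (λ y → not (x ≡ᵇ y)) (dedup xs)
dedup-∷ x xs = cong (x ∷_) (filter-does _ (dedup xs))

length≡occ+others : ∀ x l → length l ≡ occ x l + length (filterᵇ (λ y → not (x ≡ᵇ y)) l)
length≡occ+others x [] = refl
length≡occ+others x (y ∷ l) rewrite occ-∷ x y l | filterᵇ-∷ (λ y → not (x ≡ᵇ y)) y l | ≡ᵇ-sym x y with y ≡ᵇ x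
... | true = cong suc (length≡occ+others x l)
... | false = trans (cong suc (length≡occ+others x l)) (sym (+-suc (occ x l) _))

occ-filter-other : ∀ x y l → (y ≡ᵇ x) ≡ false → occ x (filterᵇ (λ z → not (y ≡ᵇ z)) l) ≡ occ x l
occ-filter-other x y [] _ = refl
occ-filter-other x y (z ∷ l) y≢x rewrite filterᵇ-∷ (λ z → not (y ≡ᵇ z)) z l | occ-∷ x z l with z ≡ᵇ x in z≡x
... | true rewrite ≡ᵇ⇒≡ z x (≡true⇒T z≡x) | y≢x | occ-∷ x x (filterᵇ (λ z → not (y ≡ᵇ z)) l) | ≡ᵇ-refl x = cong suc (occ-filter-other x y l y≢x)
... | false with y ≡ᵇ z
... | true = occ-filter-other x y l y≢x
... | false rewrite occ-∷ x z (filterᵇ (λ z → not (y ≡ᵇ z)) l) | z≡x = occ-filter-other x y l y≢x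

occ-filter-self : ∀ x l → occ x (filterᵇ (λ z → not (x ≡ᵇ z)) l) ≡ 0
occ-filter-self x [] = refl
occ-filter-self x (z ∷ l) rewrite filterᵇ-∷ (λ z → not (x ≡ᵇ z)) z l | ≡ᵇ-sym x z with z ≡ᵇ x in z≡x
... | true = occ-filter-self x l
... | false rewrite occ-∷ x z (filterᵇ (λ z → not (x ≡ᵇ z)) l) | z≡x = occ-filter-self x l

occ-dedup : ∀ x l → occ x (dedup l) ≡ b2n (memberᵇ x l)
occ-dedup x [] = refl
occ-dedup x (y ∷ l) = trans (cong (occ x) (dedup-∷ y l)) (head y)
  where
  head : ∀ y → occ x (y ∷ filterᵇ (λ z → not (y ≡ᵇ z)) (dedup l)) ≡ b2n (memberᵇ x (y ∷ l))
  head y rewrite occ-∷ x y (filterᵇ (λ z → not (y ≡ᵇ z)) (dedup l)) with y ≡ᵇ x in y≡x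
  ... | true with ≡ᵇ⇒≡ y x (≡true⇒T y≡x)
  ... | refl = cong suc (occ-filter-self x (dedup l))
  head y | false = trans (occ-filter-other x y (dedup l) y≡x) (occ-dedup x l)

length-dedup : ∀ l → length (dedup l) ≡ distinctCount l
length-dedup [] = refl
length-dedup (x ∷ xs) = trans (cong length (dedup-∷ x xs)) (step (memberᵇ x xs) (trans (length≡occ+others x (dedup xs)) (cong (_+ length F) (occ-dedup x xs))))
  where
  F = filterᵇ (λ y → not (x ≡ᵇ y)) (dedup xs)
  step : ∀ b → length (dedup xs) ≡ b2n b + length F → suc (length F) ≡ (if b then 0 else 1) + distinctCount xs
  step true e = trans (sym e) (length-dedup xs)
  step false e = cong suc (trans (sym e) (length-dedup xs))

distinctCount-++ : ∀ L M → distinctCount (L ++ M) ≡ distinctIn L M + distinctCount M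
distinctCount-++ [] M = refl
distinctCount-++ (x ∷ L) M rewrite distinctCount-++ L M = sym (+-assoc (if memberᵇ x (L ++ M) then 0 else 1) (distinctIn L M) (distinctCount M))

memberᵇ-++ : ∀ x L M → memberᵇ x (L ++ M) ≡ memberᵇ x L ∨ memberᵇ x M
memberᵇ-++ x [] M = refl
memberᵇ-++ x (y ∷ L) M rewrite memberᵇ-++ x L M with y ≡ᵇ x
... | true = refl
... | false = refl

distinctIn-cong : ∀ L M M′ → (∀ x → memberᵇ x M ≡ memberᵇ x M′) → distinctIn L M ≡ distinctIn L M′
distinctIn-cong [] M M′ _ = refl
distinctIn-cong (x ∷ L) M M′ same rewrite memberᵇ-++ x L M | memberᵇ-++ x L M′ | same x | distinctIn-cong L M M′ same = refl

distinctIn-∉ : ∀ r L M → r ∉ L → distinctIn L (r ∷ M) ≡ distinctIn L M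
distinctIn-∉ r [] M _ = refl
distinctIn-∉ r (x ∷ L) M r∉ rewrite memberᵇ-++ x L (r ∷ M) | memberᵇ-++ x L M | ≡ᵇ-sym r x with x ≡ᵇ r
... | false = cong ((if memberᵇ x L ∨ memberᵇ x M then 0 else 1) +_) (distinctIn-∉ r L M r∉)

∉⇒memberᵇ-false : ∀ x l → x ∉ l → memberᵇ x l ≡ false
∉⇒memberᵇ-false x [] _ = refl
∉⇒memberᵇ-false x (y ∷ l) x∉ with y ≡ᵇ x
... | false = ∉⇒memberᵇ-false x l x∉

memberᵇ-hit : ∀ x L M → memberᵇ x (L ++ x ∷ M) ≡ true
memberᵇ-hit x L M rewrite memberᵇ-++ x L (x ∷ M) | ≡ᵇ-refl x = ∨-zeroʳ (memberᵇ x L)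

record InT51 (s : List ℕ) : Set where
  field
    ascent : T (isAscent s)
    not-identity : T (not (isIdentity s))
    next-minimum : suc (rpos s) < rmin s
    next-below-sebr : RminAt s (suc (rpos s)) < sebr s
    next-adjacent : PrmAt s (suc (rpos s)) ≡ PrmAt s (rpos s) + 1

inT51-intro : ∀ s → InT51 s → T (inT51 s)
inT51-intro s h = pair-∧ {inA1 s}
    (pair-∧ {inAstar s} (pair-∧ {isAscent s} ascent not-identity)
      (pair-∧ {rpos s + 1 <ᵇ rmin s} (<⇒<ᵇ (subst (_< rmin s) +1≡suc next-minimum))
        (≤⇒≤ᵇ (<⇒≤ (subst (λ i → RminAt s i < sebr s) +1≡suc next-below-sebr)))))
    (pair-∧ {RminAt s (rpos s + 1) <ᵇ sebr s} (<⇒<ᵇ (subst (λ i → RminAt s i < sebr s) +1≡suc next-below-sebr))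
      (≡⇒≡ᵇ _ _ (subst (λ i → PrmAt s i ≡ PrmAt s (rpos s) + 1) +1≡suc next-adjacent)))
  where
  open InT51 h
  +1≡suc : suc (rpos s) ≡ rpos s + 1
  +1≡suc = +-comm 1 (rpos s)

inT51-elim : ∀ s → T (inT51 s) → InT51 s
inT51-elim s h = record
  { ascent = proj₁ (split-∧ {isAscent s} (proj₁ astar))
  ; not-identity = proj₂ (split-∧ {isAscent s} (proj₁ astar))
  ; next-minimum = subst (_< rmin s) suc≡ (<ᵇ⇒< _ _ (proj₁ (split-∧ {rpos s + 1 <ᵇ rmin s} (proj₂ astar))))
  ; next-below-sebr = subst (λ i → RminAt s i < sebr s) suc≡ (<ᵇ⇒< _ _ (proj₁ t51))
  ; next-adjacent = subst (λ i → PrmAt s i ≡ PrmAt s (rpos s) + 1) suc≡ (≡ᵇ⇒≡ _ _ (proj₂ t51))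
  }
  where
  a1 = split-∧ {inA1 s} h
  astar = split-∧ {inAstar s} (proj₁ a1)
  t51 = split-∧ {RminAt s (rpos s + 1) <ᵇ sebr s} (proj₂ a1)
  suc≡ : rpos s + 1 ≡ suc (rpos s)
  suc≡ = +-comm (rpos s) 1

domTail : ℕ → List ℕ → ℕ → List ℕ → List ℕ
domTail r X r′ B = r ∷ X ++ r ∷ r′ ∷ B

codTail : ℕ → List ℕ → ℕ → List ℕ → List ℕ
codTail r X r′ B = r ∷ r′ ∷ X ++ r′ ∷ B

domSeq : List ℕ → ℕ → List ℕ → ℕ → List ℕ → List ℕ
domSeq A r X r′ B = A ++ domTail r X r′ B

codSeq : List ℕ → ℕ → List ℕ → ℕ → List ℕ → List ℕ
codSeq A r X r′ B = A ++ codTail r X r′ B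

record Block (r : ℕ) (X : List ℕ) (r′ : ℕ) (B : List ℕ) : Set where
  field
    r′<X : T (allGt r′ X)
    r<r′ : r < r′
    r′<B : T (allGt r′ B)

record RposBlock (r : ℕ) (X : List ℕ) (r′ : ℕ) (B : List ℕ) : Set where
  field
    block : Block r X r′ B
    B-unqualified : ∀ j → j < rminCount B → qualifies B j ≡ false

allGt-tails : ∀ x r X r′ B → allGt x (domTail r X r′ B) ≡ allGt x (codTail r X r′ B)
allGt-tails x r X r′ B rewrite all-++ (λ y → x <ᵇ y) X (r ∷ r′ ∷ B) | all-++ (λ y → x <ᵇ y) X (r′ ∷ B) =
  reorder (x <ᵇ r) (x <ᵇ r′) (allGt x X) (allGt x B)
  where
  reorder : ∀ a b c d → (a ∧ (c ∧ (a ∧ (b ∧ d)))) ≡ (a ∧ (b ∧ (c ∧ (b ∧ d))))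
  reorder true true c d = refl
  reorder true false true d = refl
  reorder true false false d = refl
  reorder false b c d = refl

memberᵇ-tails : ∀ y r X r′ B → memberᵇ y (domTail r X r′ B) ≡ memberᵇ y (codTail r X r′ B)
memberᵇ-tails y r X r′ B rewrite memberᵇ-++ y X (r ∷ r′ ∷ B) | memberᵇ-++ y X (r′ ∷ B) =
  reorder (r ≡ᵇ y) (r′ ≡ᵇ y) (memberᵇ y X) (memberᵇ y B)
  where
  reorder : ∀ a b c d → (a ∨ (c ∨ (a ∨ (b ∨ d)))) ≡ (a ∨ (b ∨ (c ∨ (b ∨ d))))
  reorder true b c d = refl
  reorder false true true d = refl
  reorder false true false d = refl
  reorder false false c d = refl

-- In both sequences r and r′ are consecutive right-to-left minima, with index k and k + 1.
module BlockFacts (A : List ℕ) {r : ℕ} {X : List ℕ} {r′ : ℕ} {B : List ℕ} (b : Block r X r′ B) where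
  open Block b public

  k : ℕ
  k = length (rminIdx A (domTail r X r′ B))

  r<X : T (allGt r X)
  r<X = allGt-≤ X r<r′ r′<X

  r<r′B : T (allGt r (r′ ∷ B))
  r<r′B = pair-∧ {r <ᵇ r′} (<⇒<ᵇ r<r′) (allGt-≤ B r<r′ r′<B)

  r<codRest : T (allGt r (r′ ∷ X ++ r′ ∷ B))
  r<codRest rewrite all-++ (λ y → r <ᵇ y) X (r′ ∷ B) = pair-∧ {r <ᵇ r′} (<⇒<ᵇ r<r′) (pair-∧ {allGt r X} r<X r<r′B)

  s : List ℕ
  s = domSeq A r X r′ B

  t : List ℕ
  t = codSeq A r X r′ B

  s′ : List ℕ
  s′ = (A ++ r ∷ X) ++ r ∷ r′ ∷ B

  s≡s′ : s ≡ s′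
  s≡s′ = sym (++-assoc A (r ∷ X) (r ∷ r′ ∷ B))

  module Ss = RminSplit (A ++ r ∷ X) r (r′ ∷ B) r<r′B
  module St = RminSplit A r (r′ ∷ X ++ r′ ∷ B) r<codRest
  module Sr′B = RminSplit [] r′ B r′<B
  module Sr′X = RminSplit (r′ ∷ X) r′ B r′<B

  -- The first r of s is not a right-to-left minimum, the second one is.
  rX-below : rminIdx (r ∷ X) (r ∷ r′ ∷ B) ≡ []
  rX-below = rminIdx-below (r ∷ X) r (r′ ∷ B) (pair-∧ {r ≤ᵇ r} (≤⇒≤ᵇ (≤-refl {r})) (allGt⇒allGe r X r<X))

  rminIdx-prefix : rminIdx (A ++ r ∷ X) (r ∷ r′ ∷ B) ≡ rminIdx A (domTail r X r′ B) ++ []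
  rminIdx-prefix rewrite rminIdx-++ A (r ∷ X) (r ∷ r′ ∷ B) | rX-below = refl

  c-s : Ss.c ≡ k
  c-s = trans (cong length rminIdx-prefix) (trans (length-++ (rminIdx A (domTail r X r′ B))) (+-identityʳ _))

  c-t : St.c ≡ k
  c-t = cong length (rminIdx-cong A (codTail r X r′ B) (domTail r X r′ B) (λ x → sym (allGt-tails x r X r′ B)))

  c-r′X : Sr′X.c ≡ 0
  c-r′X = cong length (rminIdx-below (r′ ∷ X) r′ B (pair-∧ {r′ ≤ᵇ r′} (≤⇒≤ᵇ (≤-refl {r′})) (allGt⇒allGe r′ X r′<X)))

  rminCount-r′X : rminCount (r′ ∷ X ++ r′ ∷ B) ≡ suc (rminCount B)
  rminCount-r′X = trans Sr′X.rminCount-s (cong (_+ suc (rminCount B)) c-r′X)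

  rminCount-s : rminCount s′ ≡ k + suc (suc (rminCount B))
  rminCount-s = trans Ss.rminCount-s (cong₂ _+_ c-s (cong suc Sr′B.rminCount-s))

  rminCount-t : rminCount t ≡ k + suc (suc (rminCount B))
  rminCount-t = trans St.rminCount-s (cong₂ _+_ c-t (cong suc rminCount-r′X))

  qualifies-r′B-0 : qualifies (r′ ∷ B) 0 ≡ false
  qualifies-r′B-0 rewrite Sr′B.RminAt-here | occAfter≡occ-drop (r′ ∷ B) r′ 0 | occ-self r′ B | ∉⇒occ≡0 r′ B (allGt⇒∉ r′ B r′<B) = refl

  RminAt-r′X-0 : RminAt (r′ ∷ X ++ r′ ∷ B) 0 ≡ r′
  RminAt-r′X-0 = trans (cong (RminAt (r′ ∷ X ++ r′ ∷ B)) (sym c-r′X)) Sr′X.RminAt-here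

  qualifies-r′X-0 : qualifies (r′ ∷ X ++ r′ ∷ B) 0 ≡ true
  qualifies-r′X-0 rewrite RminAt-r′X-0 | occAfter≡occ-drop (r′ ∷ X ++ r′ ∷ B) r′ 0 | occ-self r′ (X ++ r′ ∷ B) | occ-++ r′ X (r′ ∷ B) | occ-self r′ B =
    T⇒≡true (≤⇒≤ᵇ {2} (s≤s (≤-trans (s≤s z≤n) (m≤n+m (suc (occ r′ B)) (occ r′ X)))))

  qualifies-r′X : ∀ j → j < rminCount B → qualifies (r′ ∷ X ++ r′ ∷ B) (suc j) ≡ qualifies B j
  qualifies-r′X j j<B = trans (cong (λ c → qualifies (r′ ∷ X ++ r′ ∷ B) (suc (c + j))) (sym c-r′X)) (Sr′X.qualifies-after j j<B)

  qualifies-s : ∀ j → j < suc (rminCount B) → qualifies s′ (suc (k + j)) ≡ qualifies (r′ ∷ B) j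
  qualifies-s j j< = trans (cong (λ c → qualifies s′ (suc (c + j))) (sym c-s)) (Ss.qualifies-after j (subst (j <_) (sym Sr′B.rminCount-s) j<))

  qualifies-t : ∀ j → j < suc (rminCount B) → qualifies t (suc (k + j)) ≡ qualifies (r′ ∷ X ++ r′ ∷ B) j
  qualifies-t j j< = trans (cong (λ c → qualifies t (suc (c + j))) (sym c-t)) (St.qualifies-after j (subst (j <_) (sym rminCount-r′X) j<))

  suc-index : ∀ {c} → c ≡ k → suc k ≡ suc (c + 0)
  suc-index c≡k = cong suc (trans (sym (+-identityʳ _)) (cong (_+ 0) (sym c≡k)))

  RminAt-s-k : RminAt s′ k ≡ r
  RminAt-s-k = trans (cong (RminAt s′) (sym c-s)) Ss.RminAt-here

  RminAt-s-suc-k : RminAt s′ (suc k) ≡ r′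
  RminAt-s-suc-k = trans (cong (RminAt s′) (suc-index c-s)) (trans (Ss.RminAt-after 0) Sr′B.RminAt-here)

  RminAt-t-k : RminAt t k ≡ r
  RminAt-t-k = trans (cong (RminAt t) (sym c-t)) St.RminAt-here

  RminAt-t-suc-k : RminAt t (suc k) ≡ r′
  RminAt-t-suc-k = trans (cong (RminAt t) (suc-index c-t)) (trans (St.RminAt-after 0) RminAt-r′X-0)

  PrmAt-s-k : PrmAt s′ k ≡ suc (length (A ++ r ∷ X))
  PrmAt-s-k = trans (cong (PrmAt s′) (sym c-s)) Ss.PrmAt-here

  PrmAt-s-suc-k : PrmAt s′ (suc k) ≡ suc (suc (length (A ++ r ∷ X)))
  PrmAt-s-suc-k = trans (cong (PrmAt s′) (suc-index c-s))
    (trans (Ss.PrmAt-after 0 (subst (0 <_) (sym Sr′B.rminCount-s) (s≤s z≤n))) (cong (λ n → suc (suc n)) first-index))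
    where
    first-index : length (A ++ r ∷ X) + at0 (rminIdx (r′ ∷ B) []) 0 ≡ length (A ++ r ∷ X)
    first-index rewrite Sr′B.rminIdx-s = +-identityʳ _

  length-s : length s′ ≡ length A + suc (length X + suc (suc (length B)))
  length-s rewrite sym s≡s′ = trans (length-++ A) (cong (length A +_) (cong suc (length-++ X)))

  length-t : length t ≡ length A + suc (length X + suc (suc (length B)))
  length-t = trans (length-++ A) (cong (length A +_) (cong suc (trans (cong suc (length-++ X)) (sym (+-suc (length X) (suc (length B)))))))

  rminCount<length : k + suc (suc (rminCount B)) < length A + suc (length X + suc (suc (length B)))
  rminCount<length = subst (_≤ length A + suc (length X + suc (suc (length B)))) (+-suc k (suc (suc (rminCount B))))
    (+-mono-≤ (length-rminIdx-≤ A (domTail r X r′ B)) (s≤s (≤-trans (s≤s (s≤s (rminCount≤length B))) (m≤n+m _ (length X)))))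

  rmin-s≢length : rmin s′ ≡ length s′ → ⊥
  rmin-s≢length e = <-irrefl (trans (sym (trans (rmin≡rminCount s′) rminCount-s)) (trans e length-s)) rminCount<length

  rmin-t≢length : rmin t ≡ length t → ⊥
  rmin-t≢length e = <-irrefl (trans (sym (trans (rmin≡rminCount t) rminCount-t)) (trans e length-t)) rminCount<length

  two-r-in-tail : 2 ≤ occ r (domTail r X r′ B)
  two-r-in-tail rewrite occ-self r (X ++ r ∷ r′ ∷ B) | occ-++ r X (r ∷ r′ ∷ B) | occ-self r (r′ ∷ B) =
    s≤s (≤-trans (s≤s z≤n) (m≤n+m (suc (occ r (r′ ∷ B))) (occ r X)))

  -- Index k qualifies: both occurrences of r come after the previous right-to-left minimum, which lies in A.
  qualifies-s-k : qualifies s′ k ≡ true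
  qualifies-s-k = at-index k refl
    where
    two-after : ∀ p → p ≤ length A → 2 ≤ occAfter s′ r p
    two-after p p≤A = subst (2 ≤_) (sym (occAfter≡occ-drop s′ r p))
      (≤-trans two-r-in-tail (≤-trans (≤-reflexive (cong (occ r) (trans (sym (drop-length-++ A (domTail r X r′ B))) (cong (drop (length A)) s≡s′))))
                                      (occ-drop-antimono r s′ p≤A)))
    at-index : ∀ k′ → k′ ≡ k → qualifies s′ k′ ≡ true
    at-index zero e = T⇒≡true (≤⇒≤ᵇ (subst (λ v → 2 ≤ occAfter s′ v 0) (sym (trans (cong (RminAt s′) e) RminAt-s-k)) (two-after 0 z≤n)))
    at-index (suc k′) e = T⇒≡true (≤⇒≤ᵇ (subst (λ v → 2 ≤ occAfter s′ v (PrmAt s′ k′)) (sym (trans (cong (RminAt s′) e) RminAt-s-k)) (two-after (PrmAt s′ k′) previous≤A)))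
      where
      P = rminIdx (A ++ r ∷ X) (r ∷ r′ ∷ B)
      Q = rminIdx A (domTail r X r′ B)
      rest = suc (length (A ++ r ∷ X)) ∷ map suc (map (λ x → suc (length (A ++ r ∷ X) + x)) (rminIdx (r′ ∷ B) []))
      k′<Q : k′ < length Q
      k′<Q = subst (k′ <_) e ≤-refl
      k′<P : k′ < length P
      k′<P = subst (k′ <_) (sym c-s) k′<Q
      previous≤A : PrmAt s′ k′ ≤ length A
      previous≤A = begin
        PrmAt s′ k′             ≡⟨ cong (λ l → at0 l k′) Ss.Prm-s ⟩
        at0 (map suc P ++ rest) k′ ≡⟨ at0-++ˡ (map suc P) rest k′ (subst (k′ <_) (sym (length-map suc P)) k′<P) ⟩
        at0 (map suc P) k′      ≡⟨ at0-map suc P k′ k′<P ⟩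
        suc (at0 P k′)          ≡⟨ cong (λ l → suc (at0 l k′)) rminIdx-prefix ⟩
        suc (at0 (Q ++ []) k′)  ≡⟨ cong suc (at0-++ˡ Q [] k′ k′<Q) ⟩
        suc (at0 Q k′)          ≤⟨ rminIdx-< A (domTail r X r′ B) k′ k′<Q ⟩
        length A                ∎
        where open ≤-Reasoning

  qualifies-r′B : ∀ j → j < rminCount B → qualifies (r′ ∷ B) (suc j) ≡ qualifies B j
  qualifies-r′B = Sr′B.qualifies-after

  rmin-s : rmin s′ ≡ suc (k + suc (rminCount B))
  rmin-s = trans (rmin≡rminCount s′) (trans rminCount-s (+-suc k (suc (rminCount B))))

  rmin-t : rmin t ≡ suc (k + suc (rminCount B))
  rmin-t = trans (rmin≡rminCount t) (trans rminCount-t (+-suc k (suc (rminCount B))))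

  suc-k<rmin : suc k < suc (k + suc (rminCount B))
  suc-k<rmin = s≤s (m<m+n k z<s)

beyond : ∀ k m n → k < m → m < suc (k + n) → ∃ λ j → (m ≡ suc (k + j)) × (j < n)
beyond k (suc m) n (s≤s k≤m) (s≤s m<) = m ∸ k , cong suc (sym (m+[n∸m]≡n k≤m)) , +-cancelˡ-< k (m ∸ k) n (subst (_< k + n) (sym (m+[n∸m]≡n k≤m)) m<)

module RposBlockFacts (A : List ℕ) {r : ℕ} {X : List ℕ} {r′ : ℕ} {B : List ℕ} (rb : RposBlock r X r′ B) where
  open RposBlock rb
  open BlockFacts A block public

  rpos-s′ : rpos s′ ≡ k
  rpos-s′ = trans (rpos≡lastBelow s′ rmin-s≢length)
                 (lastBelow-≡ (qualifies s′) (rmin s′) k qualifies-s-k (subst (k <_) (sym rmin-s) (<-trans (n<1+n k) suc-k<rmin)) later)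
    where
    later : ∀ m → k < m → m < rmin s′ → qualifies s′ m ≡ false
    later m k<m m< with beyond k m (suc (rminCount B)) k<m (subst (m <_) rmin-s m<)
    ... | zero , refl , _ = trans (qualifies-s 0 (s≤s z≤n)) qualifies-r′B-0
    ... | suc j , refl , s≤s j<B = trans (qualifies-s (suc j) (s≤s j<B)) (trans (qualifies-r′B j j<B) (B-unqualified j j<B))

  rpos-s : rpos s ≡ k
  rpos-s = trans (cong rpos s≡s′) rpos-s′

  RminAt-rpos-s : RminAt s (rpos s) ≡ r
  RminAt-rpos-s = trans (cong (RminAt s) rpos-s) (trans (cong (λ l → RminAt l k) s≡s′) RminAt-s-k)

  rpos-t : rpos t ≡ suc k
  rpos-t = trans (rpos≡lastBelow t rmin-t≢length) (lastBelow-≡ (qualifies t) (rmin t) (suc k) qualifies-t-suc-k (subst (suc k <_) (sym rmin-t) suc-k<rmin) later)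
    where
    qualifies-t-suc-k : qualifies t (suc k) ≡ true
    qualifies-t-suc-k = trans (cong (λ n → qualifies t (suc n)) (sym (+-identityʳ k))) (trans (qualifies-t 0 (s≤s z≤n)) qualifies-r′X-0)
    later : ∀ m → suc k < m → m < rmin t → qualifies t m ≡ false
    later m k<m m< with beyond k m (suc (rminCount B)) (<-trans (n<1+n k) k<m) (subst (m <_) rmin-t m<)
    ... | zero , refl , _ = ⊥-elim (<-irrefl (cong suc (sym (+-identityʳ k))) k<m)
    ... | suc j , refl , s≤s j<B = trans (qualifies-t (suc j) (s≤s j<B)) (trans (qualifies-r′X j j<B) (B-unqualified j j<B))

ascentTest-ignoresSuffix : IgnoresSuffix ascentTest
ascentTest-ignoresSuffix _ _ _ _ _ = refl

module AscentTransfer (A : List ℕ) {r x : ℕ} {X′ : List ℕ} {r′ : ℕ} {B : List ℕ} (b : Block r (x ∷ X′) r′ B) where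
  open Block b

  X = x ∷ X′
  P = A ++ r ∷ []
  PX = P ++ X
  P′ = P ++ r′ ∷ []
  P′X = P′ ++ X

  r′<x : r′ < x
  r′<x = <ᵇ⇒< r′ x (proj₁ (split-∧ {r′ <ᵇ x} r′<X))

  r<X : T (allGt r X)
  r<X = allGt-≤ X r<r′ r′<X

  Ascent-A : List ℕ → Bool
  Ascent-A tail = allScan ascentTest [] A (tail ++ [])

  s-at-A = Ascent-A (domTail r X r′ B)
  s-at-r = ascentTest (suc (length A)) A r []
  s-at-X = allScan ascentTest P X ((r ∷ r′ ∷ B) ++ [])
  s-at-r₂ = ascentTest (suc (length PX)) PX r []
  s-at-r′ = ascentTest (suc (length (PX ++ r ∷ []))) (PX ++ r ∷ []) r′ []
  s-at-B = allScan ascentTest ((PX ++ r ∷ []) ++ r′ ∷ []) B []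

  t-at-A = Ascent-A (codTail r X r′ B)
  t-at-r′ = ascentTest (suc (length P)) P r′ []
  t-at-X = allScan ascentTest P′ X ((r′ ∷ B) ++ [])
  t-at-r′₂ = ascentTest (suc (length P′X)) P′X r′ []
  t-at-B = allScan ascentTest (P′X ++ r′ ∷ []) B []

  ascent-s : isAscent (domSeq A r X r′ B) ≡ s-at-A ∧ (s-at-r ∧ (s-at-X ∧ (s-at-r₂ ∧ (s-at-r′ ∧ s-at-B))))
  ascent-s rewrite isAscent≡allScan (domSeq A r X r′ B) | allScan-++ ascentTest [] A (domTail r X r′ B) []
                 | allScan-++ ascentTest P X (r ∷ r′ ∷ B) [] = refl

  ascent-t : isAscent (codSeq A r X r′ B) ≡ t-at-A ∧ (s-at-r ∧ (t-at-r′ ∧ (t-at-X ∧ (t-at-r′₂ ∧ t-at-B))))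
  ascent-t rewrite isAscent≡allScan (codSeq A r X r′ B) | allScan-++ ascentTest [] A (codTail r X r′ B) []
                 | allScan-++ ascentTest P′ X (r′ ∷ B) [] = refl

  Ascent-A-tails : Ascent-A (domTail r X r′ B) ≡ Ascent-A (codTail r X r′ B)
  Ascent-A-tails = allScan-suffix ascentTest ascentTest-ignoresSuffix [] A _ _

  asc-P′ : asc P′ ≡ suc (asc P)
  asc-P′ rewrite asc-∷ʳ P r′ | newAscent-∷ʳ A r r′ | T⇒≡true (<⇒<ᵇ r<r′) = +-comm (asc P) 1

  X-shift : allScan ascentTest P X ((r ∷ r′ ∷ B) ++ []) ≡ allScan ascentTest P′ X ((r′ ∷ B) ++ []) ∧ allScan nonMascTest P′ X ((r′ ∷ B) ++ [])
  X-shift = allScan-ascent-shift r′ X P P′ _ _ (length-∷ʳ P r′) asc-P′ (≤-trans (s≤s z≤n) (≤-reflexive (sym (length-∷ʳ A r)))) same-last r′<X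
    where
    same-last : ∀ y → r′ < y → newAscent P y ≡ newAscent P′ y
    same-last y r′<y rewrite newAscent-∷ʳ A r y | newAscent-∷ʳ P r′ y | T⇒≡true (<⇒<ᵇ r′<y) | T⇒≡true (<⇒<ᵇ (<-trans r<r′ r′<y)) = refl

  newAscent-X : ∀ v → T (allGt v X) → ∀ Q → newAscent (Q ++ X) v ≡ 0
  newAscent-X v v<X Q = trans (newAscent-++ Q x X′ v) (newAscent-allGt v X v<X)

  asc-PX : asc PX ≡ asc P + 1 + asc X
  asc-PX rewrite asc-++-∷ P x X′ | newAscent-∷ʳ A r x | T⇒≡true (<⇒<ᵇ (<-trans r<r′ r′<x)) = refl

  asc-P′X : asc P′X ≡ suc (asc P) + 1 + asc X
  asc-P′X rewrite asc-++-∷ P′ x X′ | newAscent-∷ʳ P r′ x | T⇒≡true (<⇒<ᵇ r′<x) | asc-P′ = refl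

  B-same : allScan ascentTest ((PX ++ r ∷ []) ++ r′ ∷ []) B [] ≡ allScan ascentTest (P′X ++ r′ ∷ []) B []
  B-same = allScan-ascent-prefix _ _ B [] same-length same-asc (λ z → trans (newAscent-∷ʳ (PX ++ r ∷ []) r′ z) (sym (newAscent-∷ʳ P′X r′ z)))
    where
    same-length : length ((PX ++ r ∷ []) ++ r′ ∷ []) ≡ length (P′X ++ r′ ∷ [])
    same-length rewrite length-∷ʳ (PX ++ r ∷ []) r′ | length-∷ʳ PX r | length-∷ʳ P′X r′ | length-++ P {X} | length-++ P′ {X} | length-∷ʳ P r′ = refl
    same-asc : asc ((PX ++ r ∷ []) ++ r′ ∷ []) ≡ asc (P′X ++ r′ ∷ [])
    same-asc rewrite asc-∷ʳ (PX ++ r ∷ []) r′ | asc-∷ʳ PX r | asc-∷ʳ P′X r′ | newAscent-∷ʳ PX r r′ | T⇒≡true (<⇒<ᵇ r<r′)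
                   | newAscent-X r r<X P | newAscent-X r′ r′<X P′ | asc-PX | asc-P′X
      = trans (cong (_+ 1) (+-identityʳ _)) (trans (+-comm _ 1) (sym (+-identityʳ _)))

  2≤suc-P : 2 ≤ suc (length P)
  2≤suc-P rewrite length-∷ʳ A r = s≤s (s≤s z≤n)

  length-P≤ : ∀ Q → length P ≤ length (P ++ Q)
  length-P≤ Q rewrite length-++ P {Q} = m≤m+n _ _

  first-of-X : T (allScan ascentTest P X ((r ∷ r′ ∷ B) ++ [])) → (x < suc (length P)) × (x ≤ asc P + 1)
  first-of-X h = ascentTest-elim (suc (length P)) P x (X′ ++ ((r ∷ r′ ∷ B) ++ [])) 2≤suc-P (proj₁ (split-∧ {ascentTest (suc (length P)) P x (X′ ++ ((r ∷ r′ ∷ B) ++ []))} h))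

  fits-later : ∀ w Q → w < suc (length P) → w ≤ asc P + 1 → length P ≤ length Q → asc P ≤ asc Q → T (ascentTest (suc (length Q)) Q w [])
  fits-later w Q w< w≤ P≤Q ascP≤ = ascentTest-intro _ Q w [] (≤-trans w< (s≤s P≤Q)) (≤-trans w≤ (+-monoˡ-≤ 1 ascP≤))

  P≤P′X : length P ≤ length P′X
  P≤P′X = subst (length P ≤_) (cong length (sym (++-assoc P (r′ ∷ []) X))) (length-P≤ (r′ ∷ X))

  ascP≤P′X : asc P ≤ asc P′X
  ascP≤P′X = ≤-trans (asc-++-mono P (r′ ∷ [])) (asc-++-mono P′ X)

  P≤PXr : length P ≤ length (PX ++ r ∷ [])
  P≤PXr = subst (length P ≤_) (cong length (sym (++-assoc P X (r ∷ [])))) (length-P≤ (X ++ r ∷ []))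

  ascP≤PXr : asc P ≤ asc (PX ++ r ∷ [])
  ascP≤PXr = subst (asc P ≤_) (cong asc (sym (++-assoc P X (r ∷ [])))) (asc-++-mono P (X ++ r ∷ []))

  dom⇒cod : T (isAscent (domSeq A r X r′ B)) → T (isAscent (codSeq A r X r′ B)) × T (allScan nonMascTest P′ X ((r′ ∷ B) ++ []))
  dom⇒cod h with split-∧₆ {s-at-A} {s-at-r} {s-at-X} {s-at-r₂} {s-at-r′} {s-at-B} (subst T ascent-s h)
  ... | hA , hr , hX , _ , _ , hB with split-∧ {t-at-X} (subst T X-shift hX) | first-of-X hX
  ... | hX′ , no-Masc | x< , x≤ =
    subst T (sym ascent-t) (pair-∧₆ (subst T Ascent-A-tails hA) hr
      (fits-later r′ P (<-trans r′<x x<) (≤-trans (<⇒≤ r′<x) x≤) ≤-refl ≤-refl) hX′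
      (fits-later r′ P′X (<-trans r′<x x<) (≤-trans (<⇒≤ r′<x) x≤) P≤P′X ascP≤P′X) (subst T B-same hB)) , no-Masc

  cod⇒dom : T (isAscent (codSeq A r X r′ B)) → T (allScan nonMascTest P′ X ((r′ ∷ B) ++ [])) → T (isAscent (domSeq A r X r′ B))
  cod⇒dom h no-Masc with split-∧₆ {t-at-A} {s-at-r} {t-at-r′} {t-at-X} {t-at-r′₂} {t-at-B} (subst T ascent-t h)
  ... | hA , hr , hr′ , hX′ , _ , hB with ascentTest-elim (suc (length P)) P r′ [] 2≤suc-P hr′
  ... | r′< , r′≤ =
    subst T (sym ascent-s) (pair-∧₆ (subst T (sym Ascent-A-tails) hA) hr (subst T (sym X-shift) (pair-∧ {t-at-X} hX′ no-Masc))
      (fits-later r PX (<-trans r<r′ r′<) (≤-trans (<⇒≤ r<r′) r′≤) (length-P≤ X) (asc-++-mono P X))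
      (fits-later r′ (PX ++ r ∷ []) r′< r′≤ P≤PXr ascP≤PXr) (subst T (sym B-same) hB))

  deficit : T (isAscent (domSeq A r X r′ B)) → asc P + 1 < length P
  deficit h with split-∧₆ {s-at-A} {s-at-r} {s-at-X} {s-at-r₂} {s-at-r′} {s-at-B} (subst T ascent-s h)
  ... | _ , _ , hX , _ , _ , _ =
    subst (asc P + 1 <_) (sym (length-∷ʳ A r))
      (s≤s (subst (_≤ length A) (+-comm 1 (asc P)) (asc-deficit A r x (proj₂ (first-of-X hX)) (subst (_≤ x) (+-comm 2 r) (≤-trans (s≤s r<r′) r′<x)))))

module Statistics (A : List ℕ) {r x : ℕ} {X′ : List ℕ} {r′ : ℕ} {B : List ℕ} (rb : RposBlock r (x ∷ X′) r′ B)
                  (ascent : T (isAscent (domSeq A r (x ∷ X′) r′ B))) where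
  open RposBlockFacts A rb public
  open AscentTransfer A (RposBlock.block rb) public using (X; P; r′<x; dom⇒cod; deficit; first-of-X; s-at-A; s-at-r; s-at-X; s-at-r₂; s-at-r′; s-at-B; ascent-s)

  asc-equal : asc t ≡ asc s
  asc-equal rewrite asc-++-∷ A r (X ++ r ∷ r′ ∷ B) | asc-++-∷ A r (r′ ∷ X ++ r′ ∷ B) | asc-++-∷ X r (r′ ∷ B) | asc-++-∷ X r′ B
     | T⇒≡true (<⇒<ᵇ (<-trans r<r′ r′<x)) | T⇒≡true (<⇒<ᵇ r<r′) | T⇒≡true (<⇒<ᵇ r′<x) | newAscent-allGt r X r<X | newAscent-allGt r′ X r′<X
     = cong (asc A + newAscent A r +_) (cong suc (sym (+-suc (asc X + 0) (asc (r′ ∷ B)))))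

  length-equal : length t ≡ length s
  length-equal = trans length-t (trans (sym length-s) (cong length (sym s≡s′)))

  distinct-equal : distinctCount t ≡ distinctCount s
  distinct-equal
    rewrite distinctCount-++ A (domTail r X r′ B) | distinctCount-++ A (codTail r X r′ B)
          | distinctIn-cong A (domTail r X r′ B) (codTail r X r′ B) (λ y → memberᵇ-tails y r X r′ B)
          | memberᵇ-hit r X (r′ ∷ B) | memberᵇ-hit r′ X B | distinctCount-++ X (r ∷ r′ ∷ B) | distinctCount-++ X (r′ ∷ B)
          | distinctIn-∉ r X (r′ ∷ B) (allGt⇒∉ r X r<X)
          | ∉⇒memberᵇ-false r (r′ ∷ X ++ r′ ∷ B) (allGt⇒∉ r (r′ ∷ X ++ r′ ∷ B) r<codRest) | ∉⇒memberᵇ-false r (r′ ∷ B) (allGt⇒∉ r (r′ ∷ B) r<r′B)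
          | ∉⇒memberᵇ-false r′ B (allGt⇒∉ r′ B r′<B)
    = cong (distinctIn A (codTail r X r′ B) +_) (sym (+-suc (distinctIn X (r′ ∷ B)) (suc (distinctCount B))))

  rep-equal : rep t ≡ rep s
  rep-equal = cong₂ _∸_ length-equal (trans (length-dedup t) (trans distinct-equal (sym (length-dedup s))))

  ascent-t : T (isAscent t)
  ascent-t = proj₁ (dom⇒cod ascent)

  ascent-after-A : ∀ tail → T (isAscent (A ++ r ∷ tail)) → T (allScan ascentTest P tail [])
  ascent-after-A tail h with split-∧ {allScan ascentTest [] A ((r ∷ tail) ++ [])} (subst T (trans (isAscent≡allScan (A ++ r ∷ tail)) (allScan-++ ascentTest [] A (r ∷ tail) [])) h)
  ... | _ , after = proj₂ (split-∧ {ascentTest (suc (length A)) A r (tail ++ [])} after)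

  asc-P+1<P : asc P + 1 < length P
  asc-P+1<P = deficit ascent

  r<A : r < length A
  r<A = ≤-pred (subst (suc r <_) (length-∷ʳ A r) (≤-trans (s≤s (≤-trans (n≤1+n (suc r)) (≤-trans (≤-trans (s≤s r<r′) r′<x) x≤))) asc-P+1<P))
    where
    x≤ : x ≤ asc P + 1
    x≤ = proj₂ (first-of-X (proj₁ (proj₂ (proj₂ (split-∧₆ {s-at-A} {s-at-r} {s-at-X} {s-at-r₂} {s-at-r′} {s-at-B} (subst T ascent-s ascent))))))

  -- Only positions inside A can be fixed points: r sits below its position, and after it the ascent bound lags behind.
  fixedPoints-in-A : ∀ tail → T (isAscent (A ++ r ∷ tail)) →
    maxs (A ++ r ∷ tail) ≡ length (selectScan position fixedPointTest [] A ((r ∷ tail) ++ []))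
  fixedPoints-in-A tail h
    rewrite maxs≡selectScan (A ++ r ∷ tail) | selectScan-++ position fixedPointTest [] A (r ∷ tail) []
          | ¬T⇒≡false {r ≡ᵇ length A} (λ e → <-irrefl (≡ᵇ⇒≡ r _ e) r<A)
          | fixedPoints-after-deficit P tail [] (ascent-after-A tail h) asc-P+1<P
    = trans (length-++ (selectScan position fixedPointTest [] A ((r ∷ tail) ++ []))) (+-identityʳ _)

  fixedPoints-A : ℕ
  fixedPoints-A = length (selectScan position fixedPointTest [] A (domTail r X r′ B ++ []))

  maxs-s : maxs s ≡ fixedPoints-A
  maxs-s = fixedPoints-in-A (X ++ r ∷ r′ ∷ B) ascent

  maxs-t : maxs t ≡ fixedPoints-A
  maxs-t = trans (fixedPoints-in-A (r′ ∷ X ++ r′ ∷ B) ascent-t)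
                 (cong length (selectScan-suffix position fixedPointTest (λ _ _ _ _ _ → refl) [] A _ _))

  maxs-equal : maxs t ≡ maxs s
  maxs-equal = trans maxs-t (sym maxs-s)

  fixedPoints-A≤A : fixedPoints-A ≤ length A
  fixedPoints-A≤A = length-selectScan position fixedPointTest [] A (domTail r X r′ B ++ [])

  A<s : length A < length s
  A<s rewrite length-++ A {domTail r X r′ B} = ≤-trans (≤-reflexive (+-comm 1 (length A))) (+-monoʳ-≤ (length A) (s≤s z≤n))

  ealm-equal : ealm t ≡ ealm s
  ealm-equal
    rewrite maxs-s | maxs-t | length-equal
          | ¬T⇒≡false {fixedPoints-A ≡ᵇ length s} (λ e → <-irrefl (≡ᵇ⇒≡ _ _ e) (≤-trans (s≤s fixedPoints-A≤A) A<s))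
    = at-++-∷ A r (r′ ∷ X ++ r′ ∷ B) (X ++ r ∷ r′ ∷ B) (fixedPoints-A + 1) (≤-trans (≤-reflexive (+-comm fixedPoints-A 1)) (s≤s fixedPoints-A≤A))

  rmin-equal : rmin t ≡ rmin s
  rmin-equal = trans rmin-t (trans (sym rmin-s) (cong rmin (sym s≡s′)))

  rpos-shifted : rpos t ≡ suc (rpos s)
  rpos-shifted = trans rpos-t (cong suc (sym rpos-s))

  k≡0⇔r≡0 : (r ≡ᵇ 0) ≡ (k ≡ᵇ 0)
  k≡0⇔r≡0 with r ≟ 0
  ... | yes refl = sym (T⇒≡true (≡⇒≡ᵇ k 0 (cong length (rminIdx-below A 0 (X ++ 0 ∷ r′ ∷ B) (all-≥0 A)))))
  ... | no r≢0 = trans (¬T⇒≡false (λ e → r≢0 (≡ᵇ⇒≡ r 0 e))) (sym (¬T⇒≡false (λ e → r≢0 (n≤0⇒n≡0 (r≤0 (≡ᵇ⇒≡ k 0 e))))))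
    where
    r≤0 : k ≡ 0 → r ≤ 0
    r≤0 k≡0 = subst (_≤ 0) (trans (cong (RminAt s′) (sym k≡0)) RminAt-s-k) (≤-reflexive (Rmin₀-ascent s′ (subst (T ∘ isAscent) s≡s′ ascent)))

  zeros-shifted : zeros s ≡ zeros t + χ (rpos s ≡ᵇ 0)
  zeros-shifted
    rewrite rpos-s | sym k≡0⇔r≡0 | occ-++ 0 A (domTail r X r′ B) | occ-++ 0 A (codTail r X r′ B)
          | occ-∷ 0 r (X ++ r ∷ r′ ∷ B) | occ-∷ 0 r (r′ ∷ X ++ r′ ∷ B) | occ-++ 0 X (r ∷ r′ ∷ B) | occ-∷ 0 r′ (X ++ r′ ∷ B) | occ-++ 0 X (r′ ∷ B)
          | occ-∷ 0 r (r′ ∷ B) | occ-∷ 0 r′ B | ¬T⇒≡false {r′ ≡ᵇ 0} (λ e → <-irrefl (sym (≡ᵇ⇒≡ r′ 0 e)) (≤-trans (s≤s z≤n) r<r′))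
    with r ≡ᵇ 0
  ... | true = trans (cong (occ 0 A +_) (cong suc (+-suc (occ 0 X) (occ 0 B)))) (trans (+-suc (occ 0 A) _) (+-comm 1 _))
  ... | false = sym (+-identityʳ _)

module LastTwoAtRpos (s : List ℕ) (v : ℕ) (v≡ : RminAt s (rpos s) ≡ v) (A Y Z : List ℕ) (shape : s ≡ A ++ v ∷ Y ++ v ∷ Z)
                     (v∉Y : v ∉ Y) (v∉Z : v ∉ Z) where
  module Gap = LastTwoGap A v Y Z

  occurrences : rposOccurrences s ≡ just (Gap.p , Gap.q)
  occurrences = trans (cong (λ u → lastTwo (occPositions s u)) v≡)
                      (trans (cong (λ l → lastTwo (occPositions l v)) shape) (lastTwoPositions v A Y Z v∉Y v∉Z))

  sebr≡minList : sebr s ≡ minList Y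
  sebr≡minList = trans (sebr-just s _ _ occurrences)
    (cong minList (trans (entries-between≡selectScan s Gap.p Gap.q) (trans (cong (λ l → selectScan entry (betweenTest Gap.p Gap.q) [] l []) shape) Gap.entries-between)))

  condB-gap : T (condB s) → Gap.p + 1 < Gap.q
  condB-gap h = <ᵇ⇒< _ _ (proj₁ (split-∧ {Gap.p + 1 <ᵇ Gap.q} (subst T (condB-just s _ _ occurrences) h)))

  condB-no-Masc : T (condB s) → T (allScan nonMascTest Gap.A′ Y ((v ∷ Z) ++ []))
  condB-no-Masc h = subst T no-Masc≡ (proj₂ (split-∧ {Gap.p + 1 <ᵇ Gap.q} (subst T (condB-just s _ _ occurrences) h)))
    where
    no-Masc≡ : all (λ i → not (isMasc s i)) (between s Gap.p Gap.q) ≡ allScan nonMascTest Gap.A′ Y ((v ∷ Z) ++ [])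
    no-Masc≡ = trans (no-Masc-between≡allScan s Gap.p Gap.q) (trans (cong (λ l → allScan (maskedMascTest Gap.p Gap.q) [] l []) shape) Gap.no-Masc-between)

module DomainMembership (A : List ℕ) {r x : ℕ} {X′ : List ℕ} {r′ : ℕ} {B : List ℕ} (rb : RposBlock r (x ∷ X′) r′ B)
                        (ascent : T (isAscent (domSeq A r (x ∷ X′) r′ B))) where
  open Statistics A rb ascent

  sebr≡minX : sebr s ≡ minList X
  sebr≡minX = LastTwoAtRpos.sebr≡minList s r RminAt-rpos-s A X (r′ ∷ B) refl (allGt⇒∉ r X r<X) (allGt⇒∉ r (r′ ∷ B) r<r′B)

  r′<sebr : r′ < sebr s
  r′<sebr = subst (r′ <_) (sym sebr≡minX) (allGt⇒<-minList r′ x X′ r′<X)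

  not-identity : T (not (isIdentity s))
  not-identity = ¬T⇒T-not λ id →
    no-fixedPoint-after-deficit P x (X′ ++ r ∷ r′ ∷ B) [] (ascent-after-A (X ++ r ∷ r′ ∷ B) ascent) asc-P+1<P
      (proj₂ (split-∧ {fixedPointTest (suc (length A)) A r ((X ++ r ∷ r′ ∷ B) ++ [])}
        (proj₂ (split-∧ {allScan fixedPointTest [] A (domTail r X r′ B ++ [])}
          (subst T (trans (all-pos≡allScan fixedPointTest s) (allScan-++ fixedPointTest [] A (domTail r X r′ B) [])) id)))))

  adjacent-minima : PrmAt s (suc k) ≡ PrmAt s k + 1
  adjacent-minima = trans (cong (λ l → PrmAt l (suc k)) s≡s′)
    (trans PrmAt-s-suc-k (sym (trans (cong (λ l → PrmAt l k + 1) s≡s′) (trans (cong (_+ 1) PrmAt-s-k) (+-comm _ 1)))))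

  RminAt-suc-k : RminAt s (suc k) ≡ r′
  RminAt-suc-k = trans (cong (λ l → RminAt l (suc k)) s≡s′) RminAt-s-suc-k

  in-domain : T (inT51 s)
  in-domain = inT51-intro s (record
    { ascent = ascent
    ; not-identity = not-identity
    ; next-minimum = subst (λ i → suc i < rmin s) (sym rpos-s) (subst (suc k <_) (sym (trans (cong rmin s≡s′) rmin-s)) suc-k<rmin)
    ; next-below-sebr = subst (λ i → RminAt s (suc i) < sebr s) (sym rpos-s) (subst (_< sebr s) (sym RminAt-suc-k) r′<sebr)
    ; next-adjacent = subst (λ i → PrmAt s (suc i) ≡ PrmAt s i + 1) (sym rpos-s) adjacent-minima
    })

module CodomainMembership (A : List ℕ) {r x : ℕ} {X′ : List ℕ} {r′ : ℕ} {B : List ℕ} (rb : RposBlock r (x ∷ X′) r′ B) where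
  open RposBlockFacts A rb

  X = x ∷ X′
  A′ = A ++ r ∷ []

  t≡ : t ≡ A′ ++ r′ ∷ X ++ r′ ∷ B
  t≡ = sym (++-assoc A (r ∷ []) (r′ ∷ X ++ r′ ∷ B))

  module Gap = LastTwoGap A′ r′ X B

  NoMasc : Set
  NoMasc = T (allScan nonMascTest (A′ ++ r′ ∷ []) X ((r′ ∷ B) ++ []))

  occurrences : rposOccurrences t ≡ just (Gap.p , Gap.q)
  occurrences rewrite rpos-t | RminAt-t-suc-k | t≡ = lastTwoPositions r′ A′ X B (allGt⇒∉ r′ X r′<X) (allGt⇒∉ r′ B r′<B)

  last-r : lastOf (occPositions t (RminAt t (rpos t ∸ 1))) ≡ suc (length A)
  last-r rewrite rpos-t | RminAt-t-k = lastPosition r A (r′ ∷ X ++ r′ ∷ B) (allGt⇒∉ r (r′ ∷ X ++ r′ ∷ B) r<codRest)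

  condA-t : T (condA t)
  condA-t = subst T (sym (condA-just t _ _ occurrences))
    (subst (λ n → T (n + 1 ≡ᵇ Gap.p)) (sym last-r) (≡⇒≡ᵇ _ _ (trans (+-comm (suc (length A)) 1) (cong suc (sym (length-∷ʳ A r))))))

  condB-t : NoMasc → T (condB t)
  condB-t no-Masc = subst T (sym (condB-just t _ _ occurrences)) (pair-∧ {Gap.p + 1 <ᵇ Gap.q} (<⇒<ᵇ gap) (subst T (sym no-Masc≡) no-Masc))
    where
    no-Masc≡ : all (λ i → not (isMasc t i)) (between t Gap.p Gap.q) ≡ allScan nonMascTest (A′ ++ r′ ∷ []) X ((r′ ∷ B) ++ [])
    no-Masc≡ = trans (no-Masc-between≡allScan t Gap.p Gap.q) (trans (cong (λ l → allScan (maskedMascTest Gap.p Gap.q) [] l []) t≡) Gap.no-Masc-between)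
    gap : Gap.p + 1 < Gap.q
    gap rewrite length-++ (A′ ++ r′ ∷ []) {X} | length-∷ʳ A′ r′ = s≤s (+-monoʳ-≤ (suc (length A′)) (s≤s z≤n))

  in-codomain : T (isAscent t) → NoMasc → T (inTarget t)
  in-codomain ascent no-Masc = pair-∧ {isAscent t} ascent
    (pair-∧ {not (rpos t ≡ᵇ 0)} (subst (λ n → T (not (n ≡ᵇ 0))) (sym rpos-t) tt) (pair-∧ {condA t} condA-t (condB-t no-Masc)))

record DomDecomposition (s : List ℕ) : Set where
  constructor domDecomposition
  field
    A : List ℕ
    r x : ℕ
    X′ : List ℕ
    r′ : ℕ
    B : List ℕ
    shape : s ≡ domSeq A r (x ∷ X′) r′ B
    rposBlock : RposBlock r (x ∷ X′) r′ B

module DomainGap (s : List ℕ) (h : InT51 s) (A : List ℕ) (y : ℕ) (Y′ Z : List ℕ)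
                 (shape : s ≡ A ++ RminAt s (rpos s) ∷ (y ∷ Y′) ++ RminAt s (rpos s) ∷ Z)
                 (r∉Y : RminAt s (rpos s) ∉ (y ∷ Y′)) (r∉Z : RminAt s (rpos s) ∉ Z) where
  open InT51 h

  k = rpos s
  r = RminAt s k
  r′ = RminAt s (suc k)
  Y = y ∷ Y′

  r′<Y : T (allGt r′ Y)
  r′<Y = <-minList⇒allGt r′ y Y′ (subst (r′ <_) (LastTwoAtRpos.sebr≡minList s r refl A Y Z shape r∉Y r∉Z) next-below-sebr)

  suc-k<rmin : suc k < rminCount s
  suc-k<rmin = subst (suc k <_) (rmin≡rminCount s) next-minimum

  module M₀ = MinimumSplit (minimumSplit-at s k (<-trans (n<1+n k) suc-k<rmin))
  module M₁ = MinimumSplit (minimumSplit-at s (suc k) suc-k<rmin)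

  r<R₀ : T (allGt r M₀.R)
  r<R₀ = subst (λ v → T (allGt v M₀.R)) (sym M₀.RminAt-index) M₀.v<R

  -- r occurs last at the minimum with index k, so the split M₀ is the one after the second r.
  split₀ : (M₀.L ≡ A ++ r ∷ Y) × (M₀.R ≡ Z)
  split₀ = last-occurrence-unique r M₀.L M₀.R (A ++ r ∷ Y) Z
    (trans (sym (trans M₀.shape (cong (λ v → M₀.L ++ v ∷ M₀.R) (sym M₀.RminAt-index)))) (trans shape (sym (++-assoc A (r ∷ Y) (r ∷ Z)))))
    (allGt⇒∉ r M₀.R r<R₀) r∉Z

  next-after : (M₁.L ≡ M₀.L ++ M₀.v ∷ []) × (M₀.R ≡ M₁.v ∷ M₁.R)
  next-after = split-at-next M₀.L M₀.v M₀.R M₁.L M₁.v M₁.R (trans (sym M₀.shape) M₁.shape)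
    (suc-injective (trans (sym M₁.PrmAt-index) (trans next-adjacent (trans (cong (_+ 1) M₀.PrmAt-index) (+-comm _ 1)))))

  B = M₁.R

  Z≡ : Z ≡ r′ ∷ B
  Z≡ = trans (sym (proj₂ split₀)) (trans (proj₂ next-after) (cong (_∷ B) (sym M₁.RminAt-index)))

  block : Block r Y r′ B
  block = record
    { r′<X = r′<Y
    ; r<r′ = <ᵇ⇒< r r′ (proj₁ (split-∧ {r <ᵇ r′} (subst (λ l → T (allGt r l)) (trans (proj₂ split₀) Z≡) r<R₀)))
    ; r′<B = subst (λ v → T (allGt v B)) (sym M₁.RminAt-index) M₁.v<R
    }

  module BF = BlockFacts A block

  shape′ : s ≡ domSeq A r Y r′ B
  shape′ = trans shape (cong (λ l → A ++ r ∷ Y ++ r ∷ l) Z≡)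

  k≡ : k ≡ BF.k
  k≡ = trans (sym M₀.index) (trans (cong₂ (λ L v → length (rminIdx L (v ∷ M₀.R))) (proj₁ split₀) (sym M₀.RminAt-index))
               (trans (cong (λ l → length (rminIdx (A ++ r ∷ Y) (r ∷ l))) (trans (proj₂ split₀) Z≡)) BF.c-s))

  B-unqualified : ∀ j → j < rminCount B → qualifies B j ≡ false
  B-unqualified j j<B = trans (sym (BF.qualifies-r′B j j<B)) (trans (sym (BF.qualifies-s (suc j) (s≤s j<B)))
    (lastBelow-maximal (qualifies BF.s′) (rmin BF.s′) BF.k (trans (sym (rpos≡lastBelow BF.s′ BF.rmin-s≢length)) rpos-s′) (suc (BF.k + suc j))
      (s≤s (m≤m+n BF.k (suc j)))
      (subst (suc (BF.k + suc j) <_) (sym BF.rmin-s) (s≤s (+-monoʳ-< BF.k (s≤s j<B))))))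
    where
    rpos-s′ : rpos BF.s′ ≡ BF.k
    rpos-s′ = trans (cong rpos (sym (trans shape′ BF.s≡s′))) k≡

  decomposition : DomDecomposition s
  decomposition = domDecomposition A r y Y′ r′ B shape′ (record { block = block ; B-unqualified = B-unqualified })

decompose-domain : ∀ s → T (inT51 s) → DomDecomposition s
decompose-domain s h with lastTwoOccurrences (RminAt s (rpos s)) s
... | fewer none = ⊥-elim (n≮0 (subst (RminAt s (suc (rpos s)) <_) (sebr-nothing s none) (InT51.next-below-sebr (inT51-elim s h))))
... | last-two A [] Z shape r∉Y r∉Z = ⊥-elim (n≮0 (subst (RminAt s (suc (rpos s)) <_) (LastTwoAtRpos.sebr≡minList s _ refl A [] Z shape r∉Y r∉Z) (InT51.next-below-sebr (inT51-elim s h))))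
... | last-two A (y ∷ Y′) Z shape r∉Y r∉Z = DomainGap.decomposition s (inT51-elim s h) A y Y′ Z shape r∉Y r∉Z

record CodDecomposition (t : List ℕ) : Set where
  constructor codDecomposition
  field
    A : List ℕ
    r x : ℕ
    X′ : List ℕ
    r′ : ℕ
    B : List ℕ
    shape : t ≡ codSeq A r (x ∷ X′) r′ B
    rposBlock : RposBlock r (x ∷ X′) r′ B
    no-Masc : T (allScan nonMascTest ((A ++ r ∷ []) ++ r′ ∷ []) (x ∷ X′) ((r′ ∷ B) ++ []))

module CodomainGap (t : List ℕ) (k : ℕ) (rpos≡ : rpos t ≡ suc k) (condA-t : T (condA t)) (condB-t : T (condB t))
                   (A′ : List ℕ) (y : ℕ) (Y′ Z : List ℕ)
                   (shape : t ≡ A′ ++ RminAt t (suc k) ∷ (y ∷ Y′) ++ RminAt t (suc k) ∷ Z)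
                   (r′∉Y : RminAt t (suc k) ∉ (y ∷ Y′)) (r′∉Z : RminAt t (suc k) ∉ Z) where
  r = RminAt t k
  r′ = RminAt t (suc k)
  X = y ∷ Y′

  module Last = LastTwoAtRpos t r′ (cong (RminAt t) rpos≡) A′ X Z shape r′∉Y r′∉Z
  open Last using (occurrences)

  suc-k<rmin : suc k < rminCount t
  suc-k<rmin = subst (suc k <_) (rmin≡rminCount t) (proj₂ (lastBelow-suc-holds (qualifies t) (rmin t) k (rpos≡suc⇒lastBelow t k rpos≡)))

  module M₁ = MinimumSplit (minimumSplit-at t (suc k) suc-k<rmin)
  module M₀ = MinimumSplit (minimumSplit-at t k (<-trans (n<1+n k) suc-k<rmin))

  r′<R₁ : T (allGt r′ M₁.R)
  r′<R₁ = subst (λ v → T (allGt v M₁.R)) (sym M₁.RminAt-index) M₁.v<R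

  r<R₀ : T (allGt r M₀.R)
  r<R₀ = subst (λ v → T (allGt v M₀.R)) (sym M₀.RminAt-index) M₀.v<R

  shape₀ : t ≡ M₀.L ++ r ∷ M₀.R
  shape₀ = trans M₀.shape (cong (λ v → M₀.L ++ v ∷ M₀.R) (sym M₀.RminAt-index))

  R₁≡Z : M₁.R ≡ Z
  R₁≡Z = proj₂ (last-occurrence-unique r′ M₁.L M₁.R (A′ ++ r′ ∷ X) Z
    (trans (sym (trans M₁.shape (cong (λ v → M₁.L ++ v ∷ M₁.R) (sym M₁.RminAt-index)))) (trans shape (sym (++-assoc A′ (r′ ∷ X) (r′ ∷ Z)))))
    (allGt⇒∉ r′ M₁.R r′<R₁) r′∉Z)

  -- Condition (a) puts the last r directly before the second-to-last r′.
  last-r : lastOf (occPositions t (RminAt t (rpos t ∸ 1))) ≡ suc (length M₀.L)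
  last-r = trans (cong (λ i → lastOf (occPositions t (RminAt t (i ∸ 1)))) rpos≡)
                 (trans (cong (λ l → lastOf (occPositions l r)) shape₀) (lastPosition r M₀.L M₀.R (allGt⇒∉ r M₀.R r<R₀)))

  A′-length : length A′ ≡ suc (length M₀.L)
  A′-length = suc-injective (trans (sym (≡ᵇ⇒≡ _ _ (subst (λ n → T (n + 1 ≡ᵇ Last.Gap.p)) last-r (subst T (condA-just t _ _ occurrences) condA-t))))
                                   (+-comm (suc (length M₀.L)) 1))

  A′-split : (A′ ≡ M₀.L ++ r ∷ []) × (M₀.R ≡ r′ ∷ X ++ r′ ∷ Z)
  A′-split = split-at-next M₀.L r M₀.R A′ r′ (X ++ r′ ∷ Z) (trans (sym shape₀) shape) A′-length

  A = M₀.L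
  B = Z

  r′-first-minimum : r′ ≡ at0 (rminVal M₀.R []) 0
  r′-first-minimum = trans (cong (RminAt t) (cong suc (trans (sym M₀.index) (trans (cong (λ v → length (rminIdx M₀.L (v ∷ M₀.R))) (sym M₀.RminAt-index)) (sym (+-identityʳ _))))))
    (trans (cong (λ l → RminAt l (suc (RminSplit.c M₀.L r M₀.R r<R₀ + 0))) shape₀)
      (trans (RminSplit.RminAt-after M₀.L r M₀.R r<R₀ 0) (cong (λ l → at0 l 0) (Rmin≡rminVal M₀.R))))

  r′<X : T (allGt r′ X)
  r′<X = allGe∧∉⇒allGt r′ X X≥r′ r′∉Y
    where
    r′≤ : T (allGe r′ (r′ ∷ X ++ r′ ∷ Z))
    r′≤ = subst (λ m → T (allGe m (r′ ∷ X ++ r′ ∷ Z))) (trans (cong (λ l → at0 (rminVal l []) 0) (sym (proj₂ A′-split))) (sym r′-first-minimum))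
                (Rmin₀-minimum r′ (X ++ r′ ∷ Z))
    X≥r′ : T (allGe r′ X)
    X≥r′ = proj₁ (split-∧ {allGe r′ X} (subst T (all-++ (λ z → r′ ≤ᵇ z) X (r′ ∷ Z)) (proj₂ (split-∧ {r′ ≤ᵇ r′} r′≤))))

  block : Block r X r′ B
  block = record
    { r′<X = r′<X
    ; r<r′ = <ᵇ⇒< r r′ (proj₁ (split-∧ {r <ᵇ r′} (subst (λ l → T (allGt r l)) (proj₂ A′-split) r<R₀)))
    ; r′<B = subst (λ l → T (allGt r′ l)) R₁≡Z r′<R₁
    }

  module BF = BlockFacts A block

  shape′ : t ≡ codSeq A r X r′ B
  shape′ = trans shape (trans (cong (λ a → a ++ r′ ∷ X ++ r′ ∷ Z) (proj₁ A′-split)) (++-assoc A (r ∷ []) (r′ ∷ X ++ r′ ∷ Z)))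

  k≡ : k ≡ BF.k
  k≡ = trans (sym M₀.index) (trans (cong₂ (λ v l → length (rminIdx A (v ∷ l))) (sym M₀.RminAt-index) (proj₂ A′-split)) BF.c-t)

  B-unqualified : ∀ j → j < rminCount B → qualifies B j ≡ false
  B-unqualified j j<B = trans (sym (BF.qualifies-r′X j j<B)) (trans (sym (BF.qualifies-t (suc j) (s≤s j<B)))
    (lastBelow-maximal (qualifies t′) (rmin t′) (suc BF.k) (trans (sym (rpos≡lastBelow t′ BF.rmin-t≢length)) rpos-t′) (suc (BF.k + suc j))
      (s≤s (subst (BF.k <_) (sym (+-suc BF.k j)) (s≤s (m≤m+n BF.k j))))
      (subst (suc (BF.k + suc j) <_) (sym BF.rmin-t) (s≤s (+-monoʳ-< BF.k (s≤s j<B))))))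
    where
    t′ = codSeq A r X r′ B
    rpos-t′ : rpos t′ ≡ suc BF.k
    rpos-t′ = trans (cong rpos (sym shape′)) (trans rpos≡ (cong suc k≡))

  no-Masc : T (allScan nonMascTest ((A ++ r ∷ []) ++ r′ ∷ []) X ((r′ ∷ B) ++ []))
  no-Masc = subst (λ a → T (allScan nonMascTest (a ++ r′ ∷ []) X ((r′ ∷ B) ++ []))) (proj₁ A′-split) (Last.condB-no-Masc condB-t)

  decomposition : CodDecomposition t
  decomposition = codDecomposition A r y Y′ r′ B shape′ (record { block = block ; B-unqualified = B-unqualified }) no-Masc

nonzero⇒suc : ∀ n → T (not (n ≡ᵇ 0)) → Σ ℕ λ k → n ≡ suc k
nonzero⇒suc (suc k) _ = k , refl

decompose-codomain : ∀ t → T (inTarget t) → CodDecomposition t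
decompose-codomain t h with split-∧ {isAscent t} h
... | _ , h′ with split-∧ {not (rpos t ≡ᵇ 0)} h′
... | rpos≢0 , h″ with split-∧ {condA t} h″ | nonzero⇒suc (rpos t) rpos≢0
... | condA-t , condB-t | k , rpos≡ with lastTwoOccurrences (RminAt t (suc k)) t
... | fewer none = ⊥-elim (subst T (condB-nothing t (trans (cong (λ i → lastTwo (occPositions t (RminAt t i))) rpos≡) none)) condB-t)
... | last-two A′ [] Z shape r′∉Y r′∉Z = ⊥-elim (<-irrefl q≡p+1 (Last.condB-gap condB-t))
  where
  module Last = LastTwoAtRpos t _ (cong (RminAt t) rpos≡) A′ [] Z shape r′∉Y r′∉Z
  q≡p+1 : Last.Gap.p + 1 ≡ Last.Gap.q
  q≡p+1 = trans (+-comm _ 1) (cong suc (sym (trans (cong length (++-identityʳ (A′ ++ _ ∷ []))) (length-∷ʳ A′ _))))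
... | last-two A′ (y ∷ Y′) Z shape r′∉Y r′∉Z = CodomainGap.decomposition t k rpos≡ condA-t condB-t A′ y Y′ Z shape r′∉Y r′∉Z

-- In moveMinimum the part R after the last r starts with r′, so firstOr0 R is r′.

firstOr0 : List ℕ → ℕ
firstOr0 [] = 0
firstOr0 (x ∷ _) = x

moveMinimum : ℕ → List ℕ → List ℕ
moveMinimum r s with splitLast r s
... | nothing = s
... | just (L , R) with splitLast r L
...   | nothing = s
...   | just (A , X) = A ++ r ∷ firstOr0 R ∷ X ++ R

restoreMinimum : ℕ → ℕ → List ℕ → List ℕ
restoreMinimum r′ r t with splitLast r′ t
... | nothing = t
... | just (L , B) with splitLast r′ L
...   | nothing = t
...   | just (A′ , X) = A′ ++ X ++ r ∷ r′ ∷ B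

f : List ℕ → List ℕ
f s = moveMinimum (RminAt s (rpos s)) s

g : List ℕ → List ℕ
g t = restoreMinimum (RminAt t (rpos t)) (RminAt t (rpos t ∸ 1)) t

moveMinimum-last-two : ∀ r s L R A X → splitLast r s ≡ just (L , R) → splitLast r L ≡ just (A , X) → moveMinimum r s ≡ A ++ r ∷ firstOr0 R ∷ X ++ R
moveMinimum-last-two r s L R A X e₁ e₂ with splitLast r s | e₁
... | just _ | refl with splitLast r L | e₂
...   | just _ | refl = refl

restoreMinimum-last-two : ∀ r′ r t L B A′ X → splitLast r′ t ≡ just (L , B) → splitLast r′ L ≡ just (A′ , X) → restoreMinimum r′ r t ≡ A′ ++ X ++ r ∷ r′ ∷ B
restoreMinimum-last-two r′ r t L B A′ X e₁ e₂ with splitLast r′ t | e₁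
... | just _ | refl with splitLast r′ L | e₂
...   | just _ | refl = refl

module MapOnBlock (A : List ℕ) {r : ℕ} {X : List ℕ} {r′ : ℕ} {B : List ℕ} (rb : RposBlock r X r′ B) where
  open RposBlockFacts A rb

  f-domSeq : f s ≡ t
  f-domSeq = subst (λ v → moveMinimum v s ≡ t) (sym RminAt-rpos-s)
    (moveMinimum-last-two r s (A ++ r ∷ X) (r′ ∷ B) A X
      (trans (cong (splitLast r) s≡s′) (splitLast-last r (A ++ r ∷ X) (r′ ∷ B) (allGt⇒∉ r (r′ ∷ B) r<r′B)))
      (splitLast-last r A X (allGt⇒∉ r X r<X)))

  g-codSeq : g t ≡ s
  g-codSeq = subst₂ (λ v w → restoreMinimum v w t ≡ s) (sym (trans (cong (RminAt t) rpos-t) RminAt-t-suc-k)) (sym (trans (cong (λ i → RminAt t (i ∸ 1)) rpos-t) RminAt-t-k))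
    (trans (restoreMinimum-last-two r′ r t (A ++ r ∷ r′ ∷ X) B (A ++ r ∷ []) X
       (trans (cong (splitLast r′) (sym (++-assoc A (r ∷ r′ ∷ X) (r′ ∷ B)))) (splitLast-last r′ (A ++ r ∷ r′ ∷ X) B (allGt⇒∉ r′ B r′<B)))
       (trans (cong (splitLast r′) (sym (++-assoc A (r ∷ []) (r′ ∷ X)))) (splitLast-last r′ (A ++ r ∷ []) X (allGt⇒∉ r′ X r′<X))))
     (++-assoc A (r ∷ []) (X ++ r ∷ r′ ∷ B)))

lemma19 : (n : ℕ) → Σ (List ℕ → List ℕ) λ f →
    ((s : List ℕ) → InDom n s → InCod n (f s))
  × ((s t : List ℕ) → InDom n s → InDom n t → f s ≡ f t → s ≡ t)
  × ((t : List ℕ) → InCod n t → ∃ λ s → InDom n s × f s ≡ t)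
  × ((s : List ℕ) → InDom n s →
        (asc (f s) ≡ asc s) × (rep (f s) ≡ rep s) × (maxs (f s) ≡ maxs s)
      × (ealm (f s) ≡ ealm s) × (rmin (f s) ≡ rmin s)
      × (rpos (f s) ≡ suc (rpos s))
      × (zeros s ≡ zeros (f s) + χ (rpos s ≡ᵇ 0)))
lemma19 n = f , maps-into , injective , surjective , statistics
  where
  maps-into : (s : List ℕ) → InDom n s → InCod n (f s)
  maps-into s (|s| , h) with decompose-domain s h | InT51.ascent (inT51-elim s h)
  ... | domDecomposition A r x X′ r′ B refl rb | ascent =
    subst (InCod n) (sym (MapOnBlock.f-domSeq A rb))
      ( trans (Statistics.length-equal A rb ascent) |s|
      , CodomainMembership.in-codomain A rb (Statistics.ascent-t A rb ascent) (proj₂ (AscentTransfer.dom⇒cod A (RposBlock.block rb) ascent)))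

  injective : (s s′ : List ℕ) → InDom n s → InDom n s′ → f s ≡ f s′ → s ≡ s′
  injective s s′ (_ , h) (_ , h′) e with decompose-domain s h | decompose-domain s′ h′
  ... | domDecomposition A r x X′ r′ B refl rb | domDecomposition A₂ r₂ x₂ X₂ r₂′ B₂ refl rb₂ =
    trans (sym (MapOnBlock.g-codSeq A rb))
      (trans (cong g (trans (sym (MapOnBlock.f-domSeq A rb)) (trans e (MapOnBlock.f-domSeq A₂ rb₂)))) (MapOnBlock.g-codSeq A₂ rb₂))

  surjective : (t : List ℕ) → InCod n t → ∃ λ s → InDom n s × f s ≡ t
  surjective t (|t| , h) with decompose-codomain t h
  ... | codDecomposition A r x X′ r′ B refl rb no-Masc =
    domSeq A r (x ∷ X′) r′ B , (trans (sym (Statistics.length-equal A rb ascent)) |t| , DomainMembership.in-domain A rb ascent) , MapOnBlock.f-domSeq A rb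
    where
    ascent = AscentTransfer.cod⇒dom A (RposBlock.block rb) (proj₁ (split-∧ {isAscent (codSeq A r (x ∷ X′) r′ B)} h)) no-Masc

  statistics : (s : List ℕ) → InDom n s →
      (asc (f s) ≡ asc s) × (rep (f s) ≡ rep s) × (maxs (f s) ≡ maxs s)
    × (ealm (f s) ≡ ealm s) × (rmin (f s) ≡ rmin s)
    × (rpos (f s) ≡ suc (rpos s))
    × (zeros s ≡ zeros (f s) + χ (rpos s ≡ᵇ 0))
  statistics s (_ , h) with decompose-domain s h | InT51.ascent (inT51-elim s h)
  ... | domDecomposition A r x X′ r′ B refl rb | ascent rewrite MapOnBlock.f-domSeq A rb =
      Statistics.asc-equal A rb ascent , Statistics.rep-equal A rb ascent , Statistics.maxs-equal A rb ascent
    , Statistics.ealm-equal A rb ascent , Statistics.rmin-equal A rb ascent , Statistics.rpos-shifted A rb ascent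
    , Statistics.zeros-shifted A rb ascent
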